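{- Let $(F_n)$ be the Fibonacci sequence ($F_0=0$, $F_1=F_2=1$, $F_{n+2}=F_{n+1}+F_n$). The sequence $(F_{n^2})_{n\ge1}$ is not realizable, but the sequence $(5F_{n^2})_{n\ge1}$ is realizable.
   Context: An integer sequence $(U_n)_{n\in\mathbb{N}}$ (with $\mathbb{N}=\{1,2,3,\dots\}$) is called realizable if there exist a set $X$ and a map $T\colon X\to X$ such that the number of points $x\in X$ with $T^n(x)=x$ equals $U_n$ for every $n\ge1$. Equivalently, for every $n\in\mathbb{N}$ the quantity $\sum_{d\mid n}\mu(n/d)U_d$ (with $\mu$ the Möbius function) is non-negative and divisible by $n$. -}

module Defs where

open import Data.Nat using (ℕ; zero; suc; _+_; _*_)
open import Data.Fin using (Fin)
open import Data.Product using (Σ; Σ-syntax; ∃)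
open import Function using (id; _∘_)
open import Function.Bundles using (_↔_)
open import Relation.Binary.PropositionalEquality using (_≡_)

fib : ℕ → ℕ
fib zero = 0
fib (suc zero) = 1
fib (suc (suc n)) = fib (suc n) + fib n

iter : {X : Set} → (X → X) → ℕ → X → X
iter T zero = id
iter T (suc n) = T ∘ iter T n

Per : {X : Set} → (X → X) → ℕ → Set
Per {X} T n = Σ[ x ∈ X ] (iter T n x ≡ x)

-- A sequence U indexed by ℕ = {1,2,...}, encoded as U : ℕ → ℕ where
-- U (suc k) is the (k+1)-th term (U 0 is ignored).
Realizable : (ℕ → ℕ) → Set₁
Realizable U = Σ[ X ∈ Set ] Σ[ T ∈ (X → X) ] ((k : ℕ) → Per T (suc k) ↔ Fin (U (suc k)))

module Submission where

-- A sequence is realizable iff its Möbius inversion, the number of points of least period n, is a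
-- non-negative multiple of n: a disjoint union of cycles then realizes it.
--
-- For F (n²) this fails at n = 5: the non-fixed points of period 5 fall into orbits of length 5,
-- yet F 25 − F 1 = 75024 is not divisible by 5.
--
-- For 5 F (n²), superincreasing growth gives non-negativity, and divisibility follows from the
-- Dold congruences U (p m) ≡ U m mod p^(e+1) whenever p^e ∣ m. Since F n is the φ-coefficient of
-- φ^n in ℤ[φ], these are congruences for powers of φ: Frobenius gives φ^(p²−1) ≡ 1 mod p for
-- p ≠ 5 and φ^20 ≡ 1 mod 5, such a period lifts to p^(k+1) on multiplying it by p^k, and
-- (p m)² − m² = (p² − 1) m² is a multiple of the lifted period; for p = 5 one power of 5 is
-- supplied by the factor 5.

module Sums where

  open import Data.Nat using (ℕ; zero; suc; _+_; _*_; _≤_; _<_; z≤n; s≤s; >-nonZero)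
  open import Data.Nat.Properties
  open import Data.Nat.Divisibility using (_∣_; _∣?_; ∣-refl; ∣-trans; ∣⇒≤; _∣0; ∣m∣n⇒∣m+n)
  import Data.Nat.Tactic.RingSolver as ℕ-Solver
  open import Data.Sum using (inj₁; inj₂)
  open import Relation.Binary.PropositionalEquality
  open import Relation.Nullary using (Dec; yes; no; contradiction)

  ∑< : ℕ → (ℕ → ℕ) → ℕ
  ∑< zero f = 0
  ∑< (suc n) f = ∑< n f + f n

  ∑<-cong : ∀ n {f g} → (∀ j → j < n → f j ≡ g j) → ∑< n f ≡ ∑< n g
  ∑<-cong zero f≡g = refl
  ∑<-cong (suc n) f≡g = cong₂ _+_ (∑<-cong n (λ j j<n → f≡g j (m<n⇒m<1+n j<n))) (f≡g n (n<1+n n))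

  ∑<-distrib-+ : ∀ n f g → ∑< n (λ j → f j + g j) ≡ ∑< n f + ∑< n g
  ∑<-distrib-+ zero f g = refl
  ∑<-distrib-+ (suc n) f g = trans (cong (_+ (f n + g n)) (∑<-distrib-+ n f g)) (swap (∑< n f) (∑< n g) (f n) (g n))
    where
    swap : ∀ a b x y → a + b + (x + y) ≡ a + x + (b + y)
    swap = ℕ-Solver.solve-∀

  ∑<-distribˡ-* : ∀ n c f → ∑< n (λ j → c * f j) ≡ c * ∑< n f
  ∑<-distribˡ-* zero c f = sym (*-zeroʳ c)
  ∑<-distribˡ-* (suc n) c f = trans (cong (_+ c * f n) (∑<-distribˡ-* n c f)) (sym (*-distribˡ-+ c (∑< n f) (f n)))

  ∑<-mono-≤ : ∀ n {f g} → (∀ j → j < n → f j ≤ g j) → ∑< n f ≤ ∑< n g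
  ∑<-mono-≤ zero f≤g = z≤n
  ∑<-mono-≤ (suc n) f≤g = +-mono-≤ (∑<-mono-≤ n (λ j j<n → f≤g j (m<n⇒m<1+n j<n))) (f≤g n (n<1+n n))

  ∑<-extend : ∀ {a b} f → a ≤ b → (∀ j → a ≤ j → f j ≡ 0) → ∑< b f ≡ ∑< a f
  ∑<-extend {a} {zero} f z≤n f≡0 = refl
  ∑<-extend {a} {suc b} f a≤1+b f≡0 with m≤n⇒m<n∨m≡n a≤1+b
  ... | inj₂ refl = refl
  ... | inj₁ a<1+b = trans (cong₂ _+_ (∑<-extend f (≤-pred a<1+b) f≡0) (f≡0 b (≤-pred a<1+b))) (+-identityʳ _)

  ∑<-∣ : ∀ {d} n f → (∀ j → j < n → d ∣ f j) → d ∣ ∑< n f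
  ∑<-∣ zero f d∣f = _ ∣0
  ∑<-∣ (suc n) f d∣f = ∣m∣n⇒∣m+n (∑<-∣ n f (λ j j<n → d∣f j (m<n⇒m<1+n j<n))) (d∣f n (n<1+n n))

  infix 3 _when_ _unless_
  _when_ : ∀ {A : Set} → ℕ → Dec A → ℕ
  x when yes _ = x
  x when no _ = 0

  _unless_ : ∀ {A : Set} → ℕ → Dec A → ℕ
  x unless yes _ = 0
  x unless no _ = x

  when-≤ : ∀ {A : Set} x (d : Dec A) → (x when d) ≤ x
  when-≤ x (yes _) = ≤-refl
  when-≤ x (no _) = z≤n

  ∑∣ : ℕ → ℕ → (ℕ → ℕ) → ℕ
  ∑∣ m b f = ∑< b (λ j → f (suc j) when suc j ∣? m)

  ∑∣-last : ∀ k f → ∑∣ (suc k) (suc k) f ≡ ∑∣ (suc k) k f + f (suc k)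
  ∑∣-last k f with suc k ∣? suc k
  ... | yes _ = refl
  ... | no ∤ = contradiction ∣-refl ∤

  when-split : ∀ {A B : Set} x (a : Dec A) (b : Dec B) → (B → A) → (x when a) ≡ (x when b) + ((x when a) unless b)
  when-split x (yes _) (yes _) _ = sym (+-identityʳ x)
  when-split x (no ¬a) (yes b) b⇒a = contradiction (b⇒a b) ¬a
  when-split x a (no _) _ = refl

  ∑∣-split : ∀ {m m′} → m′ ∣ m → ∀ b f →
             ∑∣ m b f ≡ ∑∣ m′ b f + ∑< b (λ j → (f (suc j) when suc j ∣? m) unless suc j ∣? m′)
  ∑∣-split {m} {m′} m′∣m b f =
    trans (∑<-cong b (λ j _ → when-split (f (suc j)) (suc j ∣? m) (suc j ∣? m′) (λ j∣m′ → ∣-trans j∣m′ m′∣m)))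
          (∑<-distrib-+ b _ _)

  ∑∣-bounded : ∀ {m b} f → 1 ≤ m → m ≤ b → ∑∣ m b f ≡ ∑∣ m m f
  ∑∣-bounded {m} f 1≤m m≤b = ∑<-extend _ m≤b beyond
    where
    beyond : ∀ j → m ≤ j → (f (suc j) when suc j ∣? m) ≡ 0
    beyond j m≤j with suc j ∣? m
    ... | no _ = refl
    ... | yes j∣m = contradiction (∣⇒≤ {{>-nonZero 1≤m}} j∣m) (<⇒≱ (s≤s m≤j))

module PrimePowers where

  open import Data.Nat using (zero; suc; _+_; _*_; _^_; _≤_; _<_; z≤n; s≤s; >-nonZero; nonTrivial⇒n>1)
  open import Data.Nat.Properties
  open import Data.Nat.Divisibility
  open import Data.Nat.Induction using (<-rec)
  open import Data.Nat.Primality using (Prime; euclidsLemma; prime⇒nonZero)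
  open import Data.Nat.Primality.Factorisation using (factorise)
  open import Data.Nat.Combinatorics using (_C_; nC1≡n; nCk+nC[k+1]≡[n+1]C[k+1]; k>n⇒nCk≡0)
  import Data.Nat.Tactic.RingSolver as ℕ-Solver
  open import Data.List using ([]; _∷_)
  open import Data.List.Relation.Unary.All using (_∷_)
  open import Data.Product using (∃-syntax; _×_; _,_)
  open import Data.Sum using (inj₁; inj₂)
  open import Relation.Binary.PropositionalEquality
  open import Relation.Nullary using (¬_; yes; no; contradiction)

  prime>1 : ∀ {p} → Prime p → 1 < p
  prime>1 {p} (Data.Nat.Primality.prime _) = nonTrivial⇒n>1 p

  [1+k]*[1+n]C[1+k]≡[1+n]*nCk : ∀ n k → suc k * (suc n C suc k) ≡ suc n * (n C k)
  [1+k]*[1+n]C[1+k]≡[1+n]*nCk zero zero = refl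
  [1+k]*[1+n]C[1+k]≡[1+n]*nCk zero (suc k)
    rewrite k>n⇒nCk≡0 {1} {suc (suc k)} (s≤s (s≤s z≤n)) | k>n⇒nCk≡0 {0} {suc k} (s≤s z≤n)
    = *-zeroʳ (suc (suc k))
  [1+k]*[1+n]C[1+k]≡[1+n]*nCk (suc n) zero rewrite nC1≡n (suc (suc n)) = *-comm 1 (suc (suc n))
  [1+k]*[1+n]C[1+k]≡[1+n]*nCk (suc n) (suc k) = begin
    suc (suc k) * (suc (suc n) C suc (suc k))
      ≡⟨ cong (suc (suc k) *_) (nCk+nC[k+1]≡[n+1]C[k+1] (suc n) (suc k)) ⟨
    suc (suc k) * (suc n C suc k + suc n C suc (suc k))
      ≡⟨ split (suc k) (suc n C suc k) (suc n C suc (suc k)) ⟩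
    suc n C suc k + suc k * (suc n C suc k) + suc (suc k) * (suc n C suc (suc k))
      ≡⟨ cong₂ (λ u v → suc n C suc k + u + v) ([1+k]*[1+n]C[1+k]≡[1+n]*nCk n k) ([1+k]*[1+n]C[1+k]≡[1+n]*nCk n (suc k)) ⟩
    suc n C suc k + suc n * (n C k) + suc n * (n C suc k)
      ≡⟨ merge (suc n) (suc n C suc k) (n C k) (n C suc k) ⟩
    suc n C suc k + suc n * (n C k + n C suc k)
      ≡⟨ cong (λ c → suc n C suc k + suc n * c) (nCk+nC[k+1]≡[n+1]C[k+1] n k) ⟩
    suc n C suc k + suc n * (suc n C suc k)
      ∎
    where
    open ≡-Reasoning
    split : ∀ a x y → suc a * (x + y) ≡ x + a * x + suc a * y
    split = ℕ-Solver.solve-∀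
    merge : ∀ m c x y → c + m * x + m * y ≡ c + m * (x + y)
    merge = ℕ-Solver.solve-∀

  prime∣pC[1+k] : ∀ {n} → Prime (suc n) → ∀ {k} → k < n → suc n ∣ suc n C suc k
  prime∣pC[1+k] {n} p-prime {k} k<n
    with euclidsLemma (suc k) (suc n C suc k) p-prime
           (divides (n C k) (trans ([1+k]*[1+n]C[1+k]≡[1+n]*nCk n k) (*-comm (suc n) (n C k))))
  ... | inj₂ p∣pCk = p∣pCk
  ... | inj₁ p∣1+k = contradiction (∣⇒≤ p∣1+k) (<⇒≱ (s≤s k<n))

  module _ {p} (p-prime : Prime p) where

    private instance _ = prime⇒nonZero p-prime

    prime^∣*⇒∣ : ∀ {c} → ¬ p ∣ c → ∀ e {d} → p ^ e ∣ c * d → p ^ e ∣ d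
    prime^∣*⇒∣ p∤c zero = λ _ → 1∣ _
    prime^∣*⇒∣ {c} p∤c (suc e) {d} p^[1+e]∣cd with euclidsLemma c d p-prime (∣-trans (m∣m*n (p ^ e)) p^[1+e]∣cd)
    ... | inj₁ p∣c = contradiction p∣c p∤c
    ... | inj₂ (divides d′ refl) =
      subst (_∣ d′ * p) (*-comm (p ^ e) p) (*-monoˡ-∣ p (prime^∣*⇒∣ p∤c e (*-cancelˡ-∣ p p^[1+e]∣pcd′)))
      where
      p^[1+e]∣pcd′ : p * p ^ e ∣ p * (c * d′)
      p^[1+e]∣pcd′ = subst (p ^ suc e ∣_) (reorder c d′ p) p^[1+e]∣cd
        where
        reorder : ∀ c d p → c * (d * p) ≡ p * (c * d)
        reorder = ℕ-Solver.solve-∀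

    prime^*-∣ : ∀ {r x} → ¬ p ∣ r → ∀ k → p ^ k ∣ x → r ∣ x → p ^ k * r ∣ x
    prime^*-∣ {r} p∤r k p^k∣x (divides s refl) =
      *-monoˡ-∣ r (prime^∣*⇒∣ p∤r k (subst (p ^ k ∣_) (*-comm s r) p^k∣x))

    split-prime-power : ∀ m → 1 ≤ m → ∃[ e ] ∃[ r ] m ≡ p ^ e * r × ¬ p ∣ r
    split-prime-power = <-rec _ split
      where
      split : ∀ m → (∀ {m′} → m′ < m → 1 ≤ m′ → ∃[ e ] ∃[ r ] m′ ≡ p ^ e * r × ¬ p ∣ r) →
              1 ≤ m → ∃[ e ] ∃[ r ] m ≡ p ^ e * r × ¬ p ∣ r
      split m rec 1≤m with p ∣? m
      ... | no p∤m = 0 , m , sym (*-identityˡ m) , p∤m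
      ... | yes (divides zero refl) = contradiction 1≤m λ ()
      ... | yes (divides m′@(suc _) refl) with rec (m<m*n m′ p (prime>1 p-prime)) (s≤s z≤n)
      ...   | e , r , m′≡p^e*r , p∤r = suc e , r , trans (cong (_* p) m′≡p^e*r) (reorder (p ^ e) r p) , p∤r
        where
        reorder : ∀ a r p → a * r * p ≡ p * a * r
        reorder = ℕ-Solver.solve-∀

    prime^∣-divisor : ∀ {d m e} → d ∣ p * m → ¬ d ∣ m → p ^ e ∣ p * m → p ^ e ∣ d
    prime^∣-divisor {d} {m} {e} (divides c pm≡cd) d∤m p^e∣pm with p ∣? c
    ... | yes (divides c′ refl) = contradiction (divides c′ (*-cancelˡ-≡ m (c′ * d) p (trans pm≡cd (reorder c′ p d)))) d∤m
      where
      reorder : ∀ c p d → c * p * d ≡ p * (c * d)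
      reorder = ℕ-Solver.solve-∀
    ... | no p∤c = prime^∣*⇒∣ p∤c e (subst (p ^ e ∣_) pm≡cd p^e∣pm)

  prime-factor : ∀ m → 2 ≤ m → ∃[ p ] Prime p × p ∣ m
  prime-factor m@(suc _) 2≤m with factorise m
  ... | record { factors = [] ; isFactorisation = m≡1 } = contradiction (sym m≡1) (<⇒≢ 2≤m)
  ... | record { factors = p ∷ _ ; isFactorisation = m≡∏ ; factorsPrime = p-prime ∷ _ } =
    p , p-prime , subst (p ∣_) (sym m≡∏) (m∣m*n _)

  ∣-by-prime-powers : ∀ {x} m → 1 ≤ m → (∀ {p} e → Prime p → p ^ suc e ∣ m → p ^ suc e ∣ x) → m ∣ x
  ∣-by-prime-powers {x} = <-rec _ step
    where
    step : ∀ m → (∀ {m′} → m′ < m → 1 ≤ m′ → (∀ {p} e → Prime p → p ^ suc e ∣ m′ → p ^ suc e ∣ x) → m′ ∣ x) →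
           1 ≤ m → (∀ {p} e → Prime p → p ^ suc e ∣ m → p ^ suc e ∣ x) → m ∣ x
    step 1 rec _ local = 1∣ x
    step m@(suc (suc _)) rec 1≤m local with prime-factor m (s≤s (s≤s z≤n))
    ... | p , p-prime , p∣m with split-prime-power p-prime m 1≤m
    ...   | zero , r , m≡1*r , p∤r = contradiction (subst (p ∣_) (trans m≡1*r (*-identityˡ r)) p∣m) p∤r
    ...   | suc e , r , m≡p^[1+e]*r , p∤r =
      subst (_∣ x) (sym m≡p^[1+e]*r) (prime^*-∣ p-prime p∤r (suc e) (local e p-prime p^[1+e]∣m) r∣x)
      where
      p^[1+e]∣m : p ^ suc e ∣ m
      p^[1+e]∣m = divides r (trans m≡p^[1+e]*r (*-comm (p ^ suc e) r))
      r∣m : r ∣ m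
      r∣m = divides (p ^ suc e) m≡p^[1+e]*r
      1≤r : 1 ≤ r
      1≤r = n≢0⇒n>0 λ { refl → contradiction (trans m≡p^[1+e]*r (*-zeroʳ (p ^ suc e))) λ () }
      r<m : r < m
      r<m = subst (r <_) (trans (*-comm r (p ^ suc e)) (sym m≡p^[1+e]*r))
              (m<m*n r (p ^ suc e) {{>-nonZero 1≤r}} 1<p^[1+e])
        where
        1<p^[1+e] : 1 < p ^ suc e
        1<p^[1+e] = <-≤-trans (prime>1 p-prime) (m≤m*n p (p ^ e) {{m^n≢0 p e {{prime⇒nonZero p-prime}}}})
      r∣x : r ∣ x
      r∣x = rec r<m 1≤r (λ k q-prime q^[1+k]∣r → local k q-prime (∣-trans q^[1+k]∣r r∣m))

module CycleSystems where

  open import Data.Bool.Properties using (T-irrelevant)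
  open import Data.Empty using (⊥-elim)
  open import Data.Fin as Fin using (Fin; toℕ; fromℕ<)
  import Data.Fin.Properties as Fin
  open import Data.Nat using (ℕ; zero; suc; _+_; _*_; _<_; NonZero)
  open import Data.Nat.Properties
  open import Data.Nat.DivMod using (_%_; _/_; m≡m%n+[m/n]*n; %-distribˡ-+; m%n%n≡m%n; m<n⇒m%n≡m; m%n<n; [m+kn]%n≡m%n)
  open import Data.Nat.Divisibility using (_∣_; divides; _∣?_; ∣⇒≤)
  open import Data.Product using (Σ-syntax; _×_; _,_)
  open import Data.Sum using (_⊎_; inj₁; inj₂)
  open import Data.Sum.Function.Propositional using (_⊎-↔_)
  open import Data.Unit using (tt)
  open import Function.Bundles using (_↔_; mk↔ₛ′)
  open import Function.Properties.Inverse using (↔-refl; ↔-sym; ↔-trans)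
  open import Relation.Binary.PropositionalEquality
  open import Relation.Nullary using (Dec; yes; no)
  open import Relation.Nullary.Decidable using (True; toWitness; fromWitness)
  open import Axiom.UniquenessOfIdentityProofs.WithK using (uip)

  open import Defs using (iter; Per; Realizable)
  open Sums

  Fin-cong : ∀ {m n} → m ≡ n → Fin m ↔ Fin n
  Fin-cong refl = ↔-refl

  realizable-cong : ∀ {U V} → (∀ k → U (suc k) ≡ V (suc k)) → Realizable U → Realizable V
  realizable-cong U≡V (X , T , Per↔) = X , T , λ k → ↔-trans (Per↔ k) (Fin-cong (U≡V k))

  Selected< : ∀ {P : ℕ → Set} → (∀ j → Dec (P j)) → (ℕ → Set) → ℕ → Set
  Selected< P? B b = Σ[ j ∈ ℕ ] j < b × True (P? j) × B j

  module _ {P : ℕ → Set} (P? : ∀ j → Dec (P j)) {B : ℕ → Set} {a : ℕ → ℕ} (B↔ : ∀ j → B j ↔ Fin (a j)) where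

    private
      selected↔ : ∀ j → (True (P? j) × B j) ↔ Fin (a j when P? j)
      selected↔ j with P? j
      ... | yes _ = ↔-trans (mk↔ₛ′ (λ (_ , x) → x) (tt ,_) (λ _ → refl) (λ _ → refl)) (B↔ j)
      ... | no _ = mk↔ₛ′ (λ ()) (λ ()) (λ ()) (λ ())

      Selected<-suc↔ : ∀ b → Selected< P? B (suc b) ↔ (Selected< P? B b ⊎ (True (P? b) × B b))
      Selected<-suc↔ b = mk↔ₛ′ to from to∘from from∘to
        where
        to : Selected< P? B (suc b) → Selected< P? B b ⊎ (True (P? b) × B b)
        to (j , j<1+b , t , x) with m<1+n⇒m<n∨m≡n j<1+b
        ... | inj₁ j<b = inj₁ (j , j<b , t , x)
        ... | inj₂ refl = inj₂ (t , x)
        from : Selected< P? B b ⊎ (True (P? b) × B b) → Selected< P? B (suc b)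
        from (inj₁ (j , j<b , t , x)) = j , m<n⇒m<1+n j<b , t , x
        from (inj₂ (t , x)) = b , n<1+n b , t , x
        to∘from : ∀ y → to (from y) ≡ y
        to∘from (inj₁ (j , j<b , t , x)) with m<1+n⇒m<n∨m≡n (m<n⇒m<1+n j<b)
        ... | inj₁ j<b′ = cong (λ j<b → inj₁ (j , j<b , t , x)) (<-irrelevant j<b′ j<b)
        ... | inj₂ refl = ⊥-elim (<-irrefl refl j<b)
        to∘from (inj₂ (t , x)) with m<1+n⇒m<n∨m≡n (n<1+n b)
        ... | inj₁ b<b = ⊥-elim (<-irrefl refl b<b)
        ... | inj₂ refl = refl
        from∘to : ∀ y → from (to y) ≡ y
        from∘to (j , j<1+b , t , x) with m<1+n⇒m<n∨m≡n j<1+b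
        ... | inj₁ _ = cong (λ j<1+b → j , j<1+b , t , x) (<-irrelevant _ j<1+b)
        ... | inj₂ refl = cong (λ j<1+b → j , j<1+b , t , x) (<-irrelevant _ j<1+b)

    Selected<↔∑< : ∀ b → Selected< P? B b ↔ Fin (∑< b (λ j → a j when P? j))
    Selected<↔∑< zero = mk↔ₛ′ (λ { (_ , () , _) }) (λ ()) (λ ()) (λ { (_ , () , _) })
    Selected<↔∑< (suc b) = ↔-trans (Selected<-suc↔ b) (↔-trans (Selected<↔∑< b ⊎-↔ selected↔ b) (↔-sym Fin.+↔⊎))

  rotate : ∀ {k} → Fin (suc k) → Fin (suc k)
  rotate {k} i = fromℕ< (m%n<n (suc (toℕ i)) (suc k))

  toℕ-iter-rotate : ∀ {k} n (i : Fin (suc k)) → toℕ (iter rotate n i) ≡ (toℕ i + n) % suc k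
  toℕ-iter-rotate {k} zero i = sym (trans (cong (_% suc k) (+-identityʳ (toℕ i))) (m<n⇒m%n≡m (Fin.toℕ<n i)))
  toℕ-iter-rotate {k} (suc n) i = begin
    toℕ (rotate (iter rotate n i))      ≡⟨ Fin.toℕ-fromℕ< _ ⟩
    suc (toℕ (iter rotate n i)) % suc k ≡⟨ cong (λ r → suc r % suc k) (toℕ-iter-rotate n i) ⟩
    suc ((toℕ i + n) % suc k) % suc k   ≡⟨ %-distribˡ-+ 1 ((toℕ i + n) % suc k) (suc k) ⟩
    (1 % suc k + (toℕ i + n) % suc k % suc k) % suc k ≡⟨ cong (λ r → (1 % suc k + r) % suc k) (m%n%n≡m%n (toℕ i + n) (suc k)) ⟩
    (1 % suc k + (toℕ i + n) % suc k) % suc k         ≡⟨ %-distribˡ-+ 1 (toℕ i + n) (suc k) ⟨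
    suc (toℕ i + n) % suc k             ≡⟨ cong (_% suc k) (+-suc (toℕ i) n) ⟨
    (toℕ i + suc n) % suc k             ∎
    where open ≡-Reasoning

  toℕ-iter-rotate≡⇒∣ : ∀ {k} n (i : Fin (suc k)) → toℕ (iter rotate n i) ≡ toℕ i → suc k ∣ n
  toℕ-iter-rotate≡⇒∣ {k} n i fixed = divides ((toℕ i + n) / suc k) (+-cancelˡ-≡ (toℕ i) n _ (begin
    toℕ i + n                                          ≡⟨ m≡m%n+[m/n]*n (toℕ i + n) (suc k) ⟩
    (toℕ i + n) % suc k + (toℕ i + n) / suc k * suc k  ≡⟨ cong (_+ (toℕ i + n) / suc k * suc k) i+n%1+k≡i ⟩
    toℕ i + (toℕ i + n) / suc k * suc k                ∎))
    where
    open ≡-Reasoning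
    i+n%1+k≡i : (toℕ i + n) % suc k ≡ toℕ i
    i+n%1+k≡i = trans (sym (toℕ-iter-rotate n i)) fixed

  ∣⇒iter-rotate≡ : ∀ {k} n (i : Fin (suc k)) → suc k ∣ n → iter rotate n i ≡ i
  ∣⇒iter-rotate≡ {k} n i (divides q refl) = Fin.toℕ-injective (begin
    toℕ (iter rotate (q * suc k) i)   ≡⟨ toℕ-iter-rotate (q * suc k) i ⟩
    (toℕ i + q * suc k) % suc k       ≡⟨ [m+kn]%n≡m%n (toℕ i) q (suc k) ⟩
    toℕ i % suc k                     ≡⟨ m<n⇒m%n≡m (Fin.toℕ<n i) ⟩
    toℕ i                             ∎)
    where open ≡-Reasoning

  module CycleSystem (O : ℕ → ℕ) where

    -- O d copies of the cycle of length d = suc k.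
    Point : Set
    Point = Σ[ k ∈ ℕ ] Fin (O (suc k)) × Fin (suc k)

    step : Point → Point
    step (k , c , i) = k , c , rotate i

    iter-step : ∀ n k c i → iter step n (k , c , i) ≡ (k , c , iter rotate n i)
    iter-step zero k c i = refl
    iter-step (suc n) k c i = cong step (iter-step n k c i)

    OnCycleDividing : ℕ → Set
    OnCycleDividing m = Selected< (λ j → suc j ∣? m) (λ j → Fin (O (suc j)) × Fin (suc j)) m

    Per-step↔ : ∀ m → .{{NonZero m}} → Per step m ↔ OnCycleDividing m
    Per-step↔ m = mk↔ₛ′ to from to∘from from∘to
      where
      period∣m : ∀ k c i → iter step m (k , c , i) ≡ (k , c , i) → suc k ∣ m
      period∣m k c i fixed = toℕ-iter-rotate≡⇒∣ m i (cong (λ (_ , _ , j) → toℕ j) (trans (sym (iter-step m k c i)) fixed))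
      to : Per step m → OnCycleDividing m
      to ((k , c , i) , fixed) = k , ∣⇒≤ (period∣m k c i fixed) , fromWitness (period∣m k c i fixed) , c , i
      from : OnCycleDividing m → Per step m
      from (k , _ , t , c , i) = (k , c , i) , trans (iter-step m k c i) (cong (λ j → k , c , j) (∣⇒iter-rotate≡ m i (toWitness t)))
      to∘from : ∀ y → to (from y) ≡ y
      to∘from (k , k<m , t , c , i) = cong₂ (λ k<m t → k , k<m , t , c , i) (<-irrelevant _ _) (T-irrelevant _ _)
      from∘to : ∀ x → from (to x) ≡ x
      from∘to ((k , c , i) , fixed) = cong ((k , c , i) ,_) (uip _ _)

    cycles-realize : Realizable (λ m → ∑∣ m m (λ d → O d * d))
    cycles-realize = Point , step , λ k →
      ↔-trans (Per-step↔ (suc k)) (Selected<↔∑< (λ j → suc j ∣? suc k) (λ j → ↔-sym Fin.*↔×) (suc k))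

module DoldCriterion where

  open import Data.Nat using (ℕ; zero; suc; _+_; _*_; _∸_; _^_; _≤_; _<_; z≤n; s≤s; pred)
  open import Data.Nat.Properties
  open import Data.Nat.Induction using (<-rec)
  open import Data.Nat.Divisibility using (_∣_; divides; _∣?_; ∣-trans; _∣0)
  open import Data.Nat.Primality using (Prime)
  open import Data.Integer as ℤ using (+_) renaming (_+_ to _+ℤ_; _-_ to _-ℤ_)
  import Data.Integer.Properties as ℤ
  import Data.Integer.Divisibility.Signed as ℤ
  open import Data.Integer.Tactic.RingSolver using (solve-∀)
  import Data.Nat.Tactic.RingSolver as ℕ-Solver
  open import Relation.Binary.PropositionalEquality
  open import Function using (_∘_)
  open import Relation.Nullary using (yes; no; contradiction)

  open Sums
  open PrimePowers
  open CycleSystems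
  open import Defs using (Realizable)

  Superincreasing : (ℕ → ℕ) → Set
  Superincreasing U = ∀ k → ∑< k (λ j → U (suc j)) ≤ U (suc k)

  DoldCongruences : (ℕ → ℕ) → Set
  DoldCongruences U = ∀ {p} e {m} → Prime p → p ^ e ∣ m → + (p ^ suc e) ℤ.∣ + U (p * m) -ℤ + U m

  module ExactPeriods (U : ℕ → ℕ) (superincreasing : Superincreasing U) (dold : DoldCongruences U) where

    -- exact m is the number of points of least period m, the Möbius inversion of U;
    -- superincreasing makes the truncated subtraction exact.
    exact-with-fuel : ℕ → ℕ → ℕ
    exact-with-fuel zero m = 0
    exact-with-fuel (suc fuel) m = U m ∸ ∑∣ m (pred m) (exact-with-fuel fuel)

    exact : ℕ → ℕ
    exact m = exact-with-fuel (suc m) m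

    exact-fuel-irrelevant : ∀ f g m → m < f → m < g → exact-with-fuel f m ≡ exact-with-fuel g m
    exact-fuel-irrelevant (suc f) (suc g) zero _ _ = refl
    exact-fuel-irrelevant (suc f) (suc g) (suc m) (s≤s m<f) (s≤s m<g) =
      cong (U (suc m) ∸_) (∑<-cong m (λ j j<m → cong (_when suc j ∣? suc m)
        (exact-fuel-irrelevant f g (suc j) (<-≤-trans (s≤s j<m) m<f) (<-≤-trans (s≤s j<m) m<g))))

    exact-unfold : ∀ m → exact m ≡ U m ∸ ∑∣ m (pred m) exact
    exact-unfold zero = refl
    exact-unfold (suc m) = cong (U (suc m) ∸_) (∑<-cong m (λ j j<m → cong (_when suc j ∣? suc m)
      (exact-fuel-irrelevant (suc m) (suc (suc j)) (suc j) (s≤s j<m) (n<1+n (suc j)))))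

    exact≤U : ∀ m → exact m ≤ U m
    exact≤U m = subst (_≤ U m) (sym (exact-unfold m)) (m∸n≤m (U m) (∑∣ m (pred m) exact))

    U≡∑∣+exact : ∀ k → U (suc k) ≡ ∑∣ (suc k) k exact + exact (suc k)
    U≡∑∣+exact k = trans (sym (m+[n∸m]≡n ∑∣≤U)) (cong (λ r → ∑∣ (suc k) k exact + r) (sym (exact-unfold (suc k))))
      where
      ∑∣≤U : ∑∣ (suc k) k exact ≤ U (suc k)
      ∑∣≤U = ≤-trans (∑<-mono-≤ k (λ j _ → ≤-trans (when-≤ _ (suc j ∣? suc k)) (exact≤U (suc j)))) (superincreasing k)

    U≡∑∣exact : ∀ k → U (suc k) ≡ ∑∣ (suc k) (suc k) exact
    U≡∑∣exact k = trans (U≡∑∣+exact k) (sym (∑∣-last k exact))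

    ∑-new-divisors : ℕ → ℕ → ℕ
    ∑-new-divisors m m′ = ∑< (pred m) (λ j → (exact (suc j) when suc j ∣? m) unless suc j ∣? m′)

    U-decomposition : ∀ {k k′} → suc k′ ∣ suc k → k′ < k →
                      U (suc k) ≡ U (suc k′) + ∑-new-divisors (suc k) (suc k′) + exact (suc k)
    U-decomposition {k} {k′} m′∣m k′<k = begin
      U (suc k)                                                         ≡⟨ U≡∑∣+exact k ⟩
      ∑∣ (suc k) k exact + exact (suc k)                                ≡⟨ cong (_+ exact (suc k)) (∑∣-split m′∣m k exact) ⟩
      ∑∣ (suc k′) k exact + ∑-new-divisors (suc k) (suc k′) + exact (suc k)
        ≡⟨ cong (λ s → s + ∑-new-divisors (suc k) (suc k′) + exact (suc k)) (∑∣-bounded exact (s≤s z≤n) k′<k) ⟩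
      ∑∣ (suc k′) (suc k′) exact + ∑-new-divisors (suc k) (suc k′) + exact (suc k)
        ≡⟨ cong (λ s → s + ∑-new-divisors (suc k) (suc k′) + exact (suc k)) (U≡∑∣exact k′) ⟨
      U (suc k′) + ∑-new-divisors (suc k) (suc k′) + exact (suc k)      ∎
      where open ≡-Reasoning

    exact-as-difference : ∀ {k k′} → suc k′ ∣ suc k → k′ < k →
                          + exact (suc k) ≡ (+ U (suc k) -ℤ + U (suc k′)) -ℤ + ∑-new-divisors (suc k) (suc k′)
    exact-as-difference {k} {k′} m′∣m k′<k =
      trans (cancel (+ U (suc k′)) (+ new) (+ exact (suc k)))
        (cong (λ u → (u -ℤ + U (suc k′)) -ℤ + new)
          (sym (trans (cong +_ (U-decomposition m′∣m k′<k))
            (trans (ℤ.pos-+ (U (suc k′) + new) (exact (suc k)))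
                   (cong (_+ℤ + exact (suc k)) (ℤ.pos-+ (U (suc k′)) new))))))
      where
      new = ∑-new-divisors (suc k) (suc k′)
      cancel : ∀ a y e → e ≡ ((a +ℤ y +ℤ e) -ℤ a) -ℤ y
      cancel = solve-∀

    prime^∣new-divisors : ∀ {k m′ p} e → Prime p → suc k ≡ p * m′ → p ^ suc e ∣ suc k →
                          (∀ {d} → d < suc k → 1 ≤ d → d ∣ exact d) → p ^ suc e ∣ ∑-new-divisors (suc k) m′
    prime^∣new-divisors {k} {m′} {p} e p-prime m≡pm′ p^[1+e]∣m IH = ∑<-∣ k _ term
      where
      term : ∀ j → j < k → p ^ suc e ∣ ((exact (suc j) when suc j ∣? suc k) unless suc j ∣? m′)
      term j j<k with suc j ∣? m′
      ... | yes _ = _ ∣0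
      ... | no j∤m′ with suc j ∣? suc k
      ...   | no _ = _ ∣0
      ...   | yes j∣m = ∣-trans (prime^∣-divisor p-prime {e = suc e} (subst (suc j ∣_) m≡pm′ j∣m) j∤m′
                                  (subst (p ^ suc e ∣_) m≡pm′ p^[1+e]∣m))
                                (IH (s≤s j<k) (s≤s z≤n))

    prime^∣exact : ∀ {k p} e → Prime p → p ^ suc e ∣ suc k → (∀ {d} → d < suc k → 1 ≤ d → d ∣ exact d) →
                   p ^ suc e ∣ exact (suc k)
    prime^∣exact {k} {p} e p-prime p^[1+e]∣m@(divides q m≡q*p^[1+e]) IH =
      below (q * p ^ e) (divides q refl) (trans m≡q*p^[1+e] (reorder q p (p ^ e)))
      where
      reorder : ∀ q p a → q * (p * a) ≡ p * (q * a)
      reorder = ℕ-Solver.solve-∀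
      below : ∀ m′ → p ^ e ∣ m′ → suc k ≡ p * m′ → p ^ suc e ∣ exact (suc k)
      below zero _ m≡0 = contradiction (trans m≡0 (*-zeroʳ p)) λ ()
      below m′@(suc k′) p^e∣m′ m≡pm′ =
        ℤ.∣⇒∣ᵤ (subst (_ ℤ.∣_) (sym (exact-as-difference (divides p m≡pm′) (≤-pred m′<m)))
          (ℤ.∣m∣n⇒∣m-n dold′ (ℤ.∣ᵤ⇒∣ (prime^∣new-divisors e p-prime m≡pm′ p^[1+e]∣m IH))))
        where
        m′<m : m′ < suc k
        m′<m = subst (m′ <_) (trans (*-comm m′ p) (sym m≡pm′)) (m<m*n m′ p (prime>1 p-prime))
        dold′ : + (p ^ suc e) ℤ.∣ + U (suc k) -ℤ + U m′
        dold′ = subst (λ n → + (p ^ suc e) ℤ.∣ + U n -ℤ + U m′) (sym m≡pm′) (dold e p-prime p^e∣m′)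

    m∣exact : ∀ m → 1 ≤ m → m ∣ exact m
    m∣exact = <-rec _ step
      where
      step : ∀ m → (∀ {d} → d < m → 1 ≤ d → d ∣ exact d) → 1 ≤ m → m ∣ exact m
      step m@(suc _) smaller 1≤m = ∣-by-prime-powers m 1≤m (λ e p-prime p^[1+e]∣m → prime^∣exact e p-prime p^[1+e]∣m smaller)

  dold⇒realizable : ∀ U → Superincreasing U → DoldCongruences U → Realizable U
  dold⇒realizable U superincreasing dold =
    realizable-cong {U = λ m → ∑∣ m m (λ d → orbits d * d)} {V = U} (sym ∘ U≡∑∣orbits) (CycleSystem.cycles-realize orbits)
    where
    open ExactPeriods U superincreasing dold
    orbits : ℕ → ℕ
    orbits zero = 0
    orbits (suc k) = _∣_.quotient (m∣exact (suc k) (s≤s z≤n))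
    U≡∑∣orbits : ∀ k → U (suc k) ≡ ∑∣ (suc k) (suc k) (λ d → orbits d * d)
    U≡∑∣orbits k = trans (U≡∑∣exact k) (∑<-cong (suc k) (λ j _ →
      cong (_when suc j ∣? suc k) (_∣_.equality (m∣exact (suc j) (s≤s z≤n)))))

module OrbitCounting where

  open import Axiom.UniquenessOfIdentityProofs.WithK using (uip)
  open import Data.Fin using (Fin)
  import Data.Fin.Properties as Fin
  open import Data.List using (List; []; _∷_; _++_; length; filter; applyUpTo; tabulate)
  open import Data.List.Properties using (length-++; length-applyUpTo; length-tabulate)
  open import Data.List.Membership.Propositional using (_∈_)
  open import Data.List.Membership.Propositional.Properties
    using (∈-++⁺ˡ; ∈-++⁺ʳ; ∈-++⁻; ∈-applyUpTo⁺; ∈-applyUpTo⁻; ∈-filter⁺; ∈-filter⁻; ∈-tabulate⁺; ∈-tabulate⁻)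

  open import Data.List.Membership.Propositional.Properties.WithK using (unique∧set⇒bag)
  open import Data.List.Relation.Binary.BagAndSetEquality using (∼bag⇒↭)
  open import Data.List.Relation.Binary.Permutation.Propositional.Properties using (↭-length)
  open import Data.List.Relation.Unary.Any using (here)
  open import Data.List.Relation.Unary.Unique.Propositional using (Unique)
  import Data.List.Relation.Unary.Unique.Propositional.Properties as Unique
  open import Data.Nat using (ℕ; zero; suc; pred; _+_; _*_; _∸_; _<_; z≤n; s≤s; >-nonZero)
  open import Data.Nat.Properties
  open import Data.Nat.Divisibility using (_∣_; ∣-refl; ∣m∣n⇒∣m+n; _∣0)
  open import Data.Nat.Induction using (<-rec)
  open import Data.Nat.Coprimality using (prime⇒coprime; coprime-Bézout)
  import Data.Nat.GCD as GCD
  open import Data.Nat.Primality using (Prime; prime⇒nonZero)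
  open import Data.Product using (∃-syntax; _,_; proj₁; proj₂)
  open import Data.Sum using (inj₁; inj₂)
  open import Function using (_∘_; _⇔_; mk⇔)
  open import Function.Bundles using (_↔_; Inverse; Equivalence)
  open import Function.Properties.Inverse using (↔⇒↣)
  open import Relation.Binary.Definitions using (DecidableEquality)
  open import Relation.Binary.PropositionalEquality
  open import Relation.Nullary using (Dec; ¬?; yes; no; contradiction)
  open import Relation.Nullary.Decidable using (via-injection)

  open import Defs using (iter; Per; Realizable)

  module _ {A : Set} (σ : A → A) where

    iter-+ : ∀ a b x → iter σ (a + b) x ≡ iter σ a (iter σ b x)
    iter-+ zero b x = refl
    iter-+ (suc a) b x = cong σ (iter-+ a b x)

    iter-σ : ∀ a x → iter σ a (σ x) ≡ σ (iter σ a x)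
    iter-σ zero x = refl
    iter-σ (suc a) x = cong σ (iter-σ a x)

    iter-fix : ∀ {x} → σ x ≡ x → ∀ k → iter σ k x ≡ x
    iter-fix fixed zero = refl
    iter-fix fixed (suc k) = trans (cong σ (iter-fix fixed k)) fixed

    iter-* : ∀ {d x} → iter σ d x ≡ x → ∀ k → iter σ (k * d) x ≡ x
    iter-* fixed zero = refl
    iter-* {d} {x} fixed (suc k) = trans (iter-+ d (k * d) x) (trans (cong (iter σ d) (iter-* fixed k)) fixed)

    fixed-by-Bézout : ∀ {a b x} → iter σ a x ≡ x → iter σ b x ≡ x → ∀ u v → 1 + u * a ≡ v * b → σ x ≡ x
    fixed-by-Bézout {a} {b} {x} a-fixed b-fixed u v 1+ua≡vb = begin
      σ x                         ≡⟨ cong σ (iter-* a-fixed u) ⟨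
      iter σ (1 + u * a) x        ≡⟨ cong (λ n → iter σ n x) 1+ua≡vb ⟩
      iter σ (v * b) x            ≡⟨ iter-* b-fixed v ⟩
      x                           ∎
      where open ≡-Reasoning

  same-members⇒length≡ : ∀ {A : Set} {xs ys : List A} → Unique xs → Unique ys → (∀ {z} → z ∈ xs ⇔ z ∈ ys) →
                         length xs ≡ length ys
  same-members⇒length≡ xs! ys! xs⇔ys = ↭-length (∼bag⇒↭ (unique∧set⇒bag xs! ys! xs⇔ys))

  module Orbits {A : Set} (_≟_ : DecidableEquality A) {p} (p-prime : Prime p)
                (σ : A → A) (σ^p≡id : ∀ x → iter σ p x ≡ x) where

    open import Data.List.Membership.DecPropositional _≟_ using (_∈?_)

    private
      n = pred p
      p≡1+n : p ≡ suc n
      p≡1+n = sym (suc-pred p {{prime⇒nonZero p-prime}})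

    σ⁻¹∘σ : ∀ x → iter σ n (σ x) ≡ x
    σ⁻¹∘σ x = trans (iter-σ σ n x) (trans (cong (λ k → iter σ k x) (sym p≡1+n)) (σ^p≡id x))

    σ-injective : ∀ {x y} → σ x ≡ σ y → x ≡ y
    σ-injective {x} {y} σx≡σy = trans (sym (σ⁻¹∘σ x)) (trans (cong (iter σ n) σx≡σy) (σ⁻¹∘σ y))

    iter-injective : ∀ a {x y} → iter σ a x ≡ iter σ a y → x ≡ y
    iter-injective zero eq = eq
    iter-injective (suc a) eq = iter-injective a (σ-injective eq)

    orbit : A → List A
    orbit x = applyUpTo (λ i → iter σ i x) p

    short-period⇒fixed : ∀ {x d} → 0 < d → d < p → iter σ d x ≡ x → σ x ≡ x
    short-period⇒fixed {x} {d} 0<d d<p d-fixed with coprime-Bézout (prime⇒coprime p-prime {{>-nonZero 0<d}} d<p)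
    ... | GCD.Bézout.+- u v 1+vd≡up = fixed-by-Bézout σ d-fixed (σ^p≡id x) v u 1+vd≡up
    ... | GCD.Bézout.-+ u v 1+up≡vd = fixed-by-Bézout σ (σ^p≡id x) d-fixed u v 1+up≡vd

    orbit-unique : ∀ {x} → σ x ≢ x → Unique (orbit x)
    orbit-unique {x} not-fixed = Unique.applyUpTo⁺₁ _ p distinct
      where
      distinct : ∀ {i j} → i < j → j < p → iter σ i x ≢ iter σ j x
      distinct {i} {j} i<j j<p σⁱx≡σʲx = not-fixed (short-period⇒fixed (m<n⇒0<n∸m i<j) (≤-<-trans (m∸n≤m j i) j<p)
        (sym (iter-injective i (begin
          iter σ i x                    ≡⟨ σⁱx≡σʲx ⟩
          iter σ j x                    ≡⟨ cong (λ k → iter σ k x) (m+[n∸m]≡n (<⇒≤ i<j)) ⟨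
          iter σ (i + (j ∸ i)) x        ≡⟨ iter-+ σ i (j ∸ i) x ⟩
          iter σ i (iter σ (j ∸ i) x)   ∎))))
        where open ≡-Reasoning

    σ∈orbit⇒∈orbit : ∀ {x y} → σ y ∈ orbit x → y ∈ orbit x
    σ∈orbit⇒∈orbit {x} {y} σy∈ with ∈-applyUpTo⁻ _ σy∈
    ... | zero , _ , σy≡x = subst (_∈ orbit x) (trans (cong (iter σ n) (sym σy≡x)) (σ⁻¹∘σ y))
                                  (∈-applyUpTo⁺ _ (subst (n <_) (sym p≡1+n) (n<1+n n)))
    ... | suc i , 1+i<p , σy≡σσⁱx =
      subst (_∈ orbit x) (sym (σ-injective σy≡σσⁱx)) (∈-applyUpTo⁺ _ (<-trans (n<1+n i) 1+i<p))

    orbit-⊆ : ∀ {L x} → x ∈ L → (∀ {y} → y ∈ L → σ y ∈ L) → ∀ {y} → y ∈ orbit x → y ∈ L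
    orbit-⊆ {L} {x} x∈L closed y∈ with ∈-applyUpTo⁻ _ y∈
    ... | i , _ , refl = iter-∈ i
      where
      iter-∈ : ∀ i → iter σ i x ∈ L
      iter-∈ zero = x∈L
      iter-∈ (suc i) = closed (iter-∈ i)

    p∣length : ∀ L → Unique L → (∀ {y} → y ∈ L → σ y ∈ L) → (∀ {y} → y ∈ L → σ y ≢ y) → p ∣ length L
    p∣length L = <-rec P step (length L) L refl
      where
      P : ℕ → Set
      P m = ∀ L → length L ≡ m → Unique L → (∀ {y} → y ∈ L → σ y ∈ L) → (∀ {y} → y ∈ L → σ y ≢ y) → p ∣ m
      step : ∀ m → (∀ {m′} → m′ < m → P m′) → P m
      step _ _ [] refl _ _ _ = _ ∣0
      step _ smaller L@(x ∷ _) refl L! closed free = subst (p ∣_) (sym length-L) (∣m∣n⇒∣m+n ∣-refl p∣L′)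
        where
        O = orbit x
        ∉O? = λ y → ¬? (y ∈? O)
        L′ = filter ∉O? L
        O! : Unique O
        O! = orbit-unique (free (here refl))
        L′! : Unique L′
        L′! = Unique.filter⁺ ∉O? L!
        O++L′! : Unique (O ++ L′)
        O++L′! = Unique.++⁺ O! L′! (λ (z∈O , z∈L′) → proj₂ (∈-filter⁻ ∉O? z∈L′) z∈O)
        same : ∀ {z} → z ∈ L ⇔ z ∈ O ++ L′
        same {z} = mk⇔ to from
          where
          to : z ∈ L → z ∈ O ++ L′
          to z∈L with z ∈? O
          ... | yes z∈O = ∈-++⁺ˡ z∈O
          ... | no z∉O = ∈-++⁺ʳ O (∈-filter⁺ ∉O? z∈L z∉O)
          from : z ∈ O ++ L′ → z ∈ L
          from z∈ with ∈-++⁻ O z∈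
          ... | inj₁ z∈O = orbit-⊆ (here refl) closed z∈O
          ... | inj₂ z∈L′ = proj₁ (∈-filter⁻ ∉O? z∈L′)
        length-L : length L ≡ p + length L′
        length-L = trans (same-members⇒length≡ L! O++L′! same)
                         (trans (length-++ O) (cong (_+ length L′) (length-applyUpTo _ p)))
        p∣L′ : p ∣ length L′
        p∣L′ = smaller (subst (length L′ <_) (sym length-L) (m<n+m (length L′) (prime>0)))
                 L′ refl L′!
                 (λ y∈L′ → let y∈L , y∉O = ∈-filter⁻ ∉O? y∈L′
                           in ∈-filter⁺ ∉O? (closed y∈L) (y∉O ∘ σ∈orbit⇒∈orbit))
                 (free ∘ proj₁ ∘ ∈-filter⁻ ∉O?)
          where
          prime>0 : 0 < p
          prime>0 = subst (0 <_) (sym p≡1+n) (s≤s z≤n)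

  module _ {A : Set} (_≟_ : DecidableEquality A) {p} (p-prime : Prime p)
           (σ : A → A) (σ^p≡id : ∀ x → iter σ p x ≡ x) where

    open Orbits _≟_ p-prime σ σ^p≡id

    length≡fixed+multiple : ∀ {L Fix} → Unique L → (∀ a → a ∈ L) → Unique Fix → (∀ {a} → a ∈ Fix ⇔ σ a ≡ a) →
                            ∃[ k ] length L ≡ length Fix + k * p
    length≡fixed+multiple {L} {Fix} L! ∈L Fix! ∈Fix⇔fixed =
      _∣_.quotient p∣M , trans length-L (cong (length Fix +_) (_∣_.equality p∣M))
      where
      nonfixed? : ∀ a → Dec (σ a ≢ a)
      nonfixed? a = ¬? (σ a ≟ a)
      M = filter nonfixed? L
      M! : Unique M
      M! = Unique.filter⁺ nonfixed? L!
      p∣M : p ∣ length M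
      p∣M = p∣length M M!
        (λ a∈M → ∈-filter⁺ nonfixed? (∈L _) (proj₂ (∈-filter⁻ nonfixed? {xs = L} a∈M) ∘ σ-injective))
        (proj₂ ∘ ∈-filter⁻ nonfixed? {xs = L})
      Fix++M! : Unique (Fix ++ M)
      Fix++M! = Unique.++⁺ Fix! M! λ (a∈Fix , a∈M) →
        proj₂ (∈-filter⁻ nonfixed? {xs = L} a∈M) (Equivalence.to ∈Fix⇔fixed a∈Fix)
      same : ∀ {a} → a ∈ L ⇔ a ∈ Fix ++ M
      same {a} with σ a ≟ a
      ... | yes σa≡a = mk⇔ (λ _ → ∈-++⁺ˡ (Equivalence.from ∈Fix⇔fixed σa≡a)) (λ _ → ∈L a)
      ... | no σa≢a = mk⇔ (λ _ → ∈-++⁺ʳ Fix (∈-filter⁺ nonfixed? (∈L a) σa≢a)) (λ _ → ∈L a)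
      length-L : length L ≡ length Fix + length M
      length-L = trans (same-members⇒length≡ L! Fix++M! same) (length-++ Fix)

  from-injective : ∀ {B : Set} {k} (e : B ↔ Fin k) {i j} → Inverse.from e i ≡ Inverse.from e j → i ≡ j
  from-injective e {i} {j} eq = trans (sym (strictlyInverseˡ e i)) (trans (cong (Inverse.to e) eq) (strictlyInverseˡ e j))
    where open Inverse using (strictlyInverseˡ)

  module _ {X : Set} (T : X → X) where

    Per-≡ : ∀ k {a b : Per T k} → proj₁ a ≡ proj₁ b → a ≡ b
    Per-≡ _ {a = x , _} refl = cong (x ,_) (uip _ _)

    shift : ∀ k → Per T k → Per T k
    shift k (x , Tᵏx≡x) = T x , trans (iter-σ T k x) (cong T Tᵏx≡x)

    shift^k≡id : ∀ k (a : Per T k) → iter (shift k) k a ≡ a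
    shift^k≡id k a = Per-≡ k (trans (proj₁-iter k) (proj₂ a))
      where
      proj₁-iter : ∀ i → proj₁ (iter (shift k) i a) ≡ iter T i (proj₁ a)
      proj₁-iter zero = refl
      proj₁-iter (suc i) = cong T (proj₁-iter i)

    fixed-points : ∀ k → Per T 1 → Per T k
    fixed-points k (x , Tx≡x) = x , iter-fix T Tx≡x k

  realizable⇒U[p]≡U[1] : ∀ {U p} → Realizable U → Prime p → ∃[ k ] U p ≡ U 1 + k * p
  realizable⇒U[p]≡U[1] {p = zero} _ p-prime = contradiction (prime⇒nonZero p-prime) λ ()
  realizable⇒U[p]≡U[1] {U} {p@(suc n)} (X , T , Per↔) p-prime =
    subst₂ (λ l f → ∃[ k ] l ≡ f + k * p) (length-tabulate _) (length-tabulate _)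
      (length≡fixed+multiple _≟Per_ p-prime (shift T p) (shift^k≡id T p) L! ∈L Fix! ∈Fix⇔fixed)
    where
    open Inverse using (to; from; strictlyInverseʳ)
    _≟Per_ : DecidableEquality (Per T p)
    _≟Per_ = via-injection (↔⇒↣ (Per↔ n)) Fin._≟_

    L = tabulate (from (Per↔ n))
    L! : Unique L
    L! = Unique.tabulate⁺ (from-injective (Per↔ n))
    ∈L : ∀ a → a ∈ L
    ∈L a = subst (_∈ L) (strictlyInverseʳ (Per↔ n) a) (∈-tabulate⁺ (to (Per↔ n) a))

    Fix = tabulate (fixed-points T p ∘ from (Per↔ 0))
    Fix! : Unique Fix
    Fix! = Unique.tabulate⁺ (from-injective (Per↔ 0) ∘ Per-≡ T 1 ∘ cong proj₁)
    ∈Fix⇔fixed : ∀ {a} → a ∈ Fix ⇔ shift T p a ≡ a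
    ∈Fix⇔fixed {a@(x , _)} = mk⇔ ⇒ ⇐
      where
      ⇒ : a ∈ Fix → shift T p a ≡ a
      ⇒ a∈Fix with ∈-tabulate⁻ a∈Fix
      ... | i , refl = Per-≡ T p (proj₂ (from (Per↔ 0) i))
      ⇐ : shift T p a ≡ a → a ∈ Fix
      ⇐ Ta≡a = subst (_∈ Fix) (Per-≡ T p (cong proj₁ (strictlyInverseʳ (Per↔ 0) (x , cong proj₁ Ta≡a))))
                     (∈-tabulate⁺ (to (Per↔ 0) (x , cong proj₁ Ta≡a)))

module GoldenIntegers where

  open import Algebra.Bundles using (CommutativeRing)
  open import Algebra.Structures using (IsCommutativeRing)
  open import Algebra.Consequences.Propositional using (comm∧idˡ⇒id; comm∧invˡ⇒inv; comm∧distrʳ⇒distrˡ)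
  open import Data.Fin as Fin using (Fin; toℕ; inject₁)
  import Data.Fin.Properties as Fin
  open import Data.Integer as ℤ using (ℤ; +_; -[1+_]; _+_; _*_; -_; 0ℤ; 1ℤ)
  import Data.Integer.Properties as ℤ
  open import Data.Integer.Divisibility.Signed
  open import Data.Integer.Tactic.RingSolver using (solve-∀)
  open import Data.List using ([]; _∷_)
  open import Data.Maybe using (Maybe; just; nothing)
  open import Data.Nat as ℕ using (ℕ; zero; suc)
  import Data.Nat.Properties as ℕ
  open import Data.Nat.Combinatorics using (_C_; nCn≡1)
  open import Data.Nat.Primality using (Prime; prime⇒nonZero)
  open PrimePowers using (prime>1; prime∣pC[1+k])
  import Data.Nat.Tactic.RingSolver as ℕ-Solver
  open import Data.Product using (_×_; _,_)
  open import Data.Vec.Functional using (init; last; tail)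
  open import Function using (_∘_)
  open import Level using (0ℓ)
  open import Relation.Binary.Bundles using (Setoid)
  open import Relation.Binary.Structures using (IsEquivalence)
  import Relation.Binary.Reasoning.Setoid
  open import Relation.Binary.PropositionalEquality
  open import Relation.Nullary using (yes; contradiction)
  import Tactic.RingSolver as RingSolver
  open import Tactic.RingSolver.Core.AlmostCommutativeRing using (AlmostCommutativeRing; fromCommutativeRing)

  -- ⟨ a , b ⟩ stands for a + b φ, where φ² = φ + 1.
  data ℤ[φ] : Set where
    ⟨_,_⟩ : ℤ → ℤ → ℤ[φ]

  infixl 6 _⊕_ _⊖_
  infixl 7 _⊗_
  infix 8 ⊖_

  _⊕_ _⊗_ : ℤ[φ] → ℤ[φ] → ℤ[φ]
  ⟨ a , b ⟩ ⊕ ⟨ c , d ⟩ = ⟨ a + c , b + d ⟩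
  ⟨ a , b ⟩ ⊗ ⟨ c , d ⟩ = ⟨ a * c + b * d , a * d + b * c + b * d ⟩

  ⊖_ : ℤ[φ] → ℤ[φ]
  ⊖ ⟨ a , b ⟩ = ⟨ - a , - b ⟩

  _⊖_ : ℤ[φ] → ℤ[φ] → ℤ[φ]
  x ⊖ y = x ⊕ ⊖ y

  𝟘 𝟙 φ : ℤ[φ]
  𝟘 = ⟨ 0ℤ , 0ℤ ⟩
  𝟙 = ⟨ 1ℤ , 0ℤ ⟩
  φ = ⟨ 0ℤ , 1ℤ ⟩

  ι : ℤ → ℤ[φ]
  ι c = ⟨ c , 0ℤ ⟩

  ⊕-assoc : ∀ x y z → (x ⊕ y) ⊕ z ≡ x ⊕ (y ⊕ z)
  ⊕-assoc ⟨ a , b ⟩ ⟨ c , d ⟩ ⟨ e , f ⟩ = cong₂ ⟨_,_⟩ (ℤ.+-assoc a c e) (ℤ.+-assoc b d f)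

  ⊕-comm : ∀ x y → x ⊕ y ≡ y ⊕ x
  ⊕-comm ⟨ a , b ⟩ ⟨ c , d ⟩ = cong₂ ⟨_,_⟩ (ℤ.+-comm a c) (ℤ.+-comm b d)

  ⊕-identityˡ : ∀ x → 𝟘 ⊕ x ≡ x
  ⊕-identityˡ ⟨ a , b ⟩ = cong₂ ⟨_,_⟩ (ℤ.+-identityˡ a) (ℤ.+-identityˡ b)

  ⊖-inverseˡ : ∀ x → ⊖ x ⊕ x ≡ 𝟘
  ⊖-inverseˡ ⟨ a , b ⟩ = cong₂ ⟨_,_⟩ (ℤ.+-inverseˡ a) (ℤ.+-inverseˡ b)

  ⊗-assoc : ∀ x y z → (x ⊗ y) ⊗ z ≡ x ⊗ (y ⊗ z)
  ⊗-assoc ⟨ a , b ⟩ ⟨ c , d ⟩ ⟨ e , f ⟩ = cong₂ ⟨_,_⟩ (re a b c d e f) (im a b c d e f)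
    where
    re : ∀ a b c d e f → (a * c + b * d) * e + (a * d + b * c + b * d) * f
                       ≡ a * (c * e + d * f) + b * (c * f + d * e + d * f)
    re = solve-∀
    im : ∀ a b c d e f → (a * c + b * d) * f + (a * d + b * c + b * d) * e + (a * d + b * c + b * d) * f
                       ≡ a * (c * f + d * e + d * f) + b * (c * e + d * f) + b * (c * f + d * e + d * f)
    im = solve-∀

  ⊗-comm : ∀ x y → x ⊗ y ≡ y ⊗ x
  ⊗-comm ⟨ a , b ⟩ ⟨ c , d ⟩ = cong₂ ⟨_,_⟩ (re a b c d) (im a b c d)
    where
    re : ∀ a b c d → a * c + b * d ≡ c * a + d * b
    re = solve-∀
    im : ∀ a b c d → a * d + b * c + b * d ≡ c * b + d * a + d * b
    im = solve-∀

  ⊗-identityˡ : ∀ x → 𝟙 ⊗ x ≡ x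
  ⊗-identityˡ ⟨ a , b ⟩ = cong₂ ⟨_,_⟩ (re a b) (im a b)
    where
    re : ∀ a b → 1ℤ * a + 0ℤ * b ≡ a
    re = solve-∀
    im : ∀ a b → 1ℤ * b + 0ℤ * a + 0ℤ * b ≡ b
    im = solve-∀

  ⊗-distribʳ-⊕ : ∀ x y z → (y ⊕ z) ⊗ x ≡ y ⊗ x ⊕ z ⊗ x
  ⊗-distribʳ-⊕ ⟨ a , b ⟩ ⟨ c , d ⟩ ⟨ e , f ⟩ = cong₂ ⟨_,_⟩ (re a b c d e f) (im a b c d e f)
    where
    re : ∀ a b c d e f → (c + e) * a + (d + f) * b ≡ (c * a + d * b) + (e * a + f * b)
    re = solve-∀
    im : ∀ a b c d e f → (c + e) * b + (d + f) * a + (d + f) * b ≡ (c * b + d * a + d * b) + (e * b + f * a + f * b)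
    im = solve-∀

  ℤ[φ]-isCommutativeRing : IsCommutativeRing _≡_ _⊕_ _⊗_ ⊖_ 𝟘 𝟙
  ℤ[φ]-isCommutativeRing = record
    { isRing = record
      { +-isAbelianGroup = record
        { isGroup = record
          { isMonoid = record
            { isSemigroup = record
              { isMagma = record { isEquivalence = isEquivalence ; ∙-cong = cong₂ _⊕_ }
              ; assoc = ⊕-assoc }
            ; identity = comm∧idˡ⇒id ⊕-comm ⊕-identityˡ }
          ; inverse = comm∧invˡ⇒inv ⊕-comm ⊖-inverseˡ
          ; ⁻¹-cong = cong (⊖_) }
        ; comm = ⊕-comm }
      ; *-cong = cong₂ _⊗_
      ; *-assoc = ⊗-assoc
      ; *-identity = comm∧idˡ⇒id ⊗-comm ⊗-identityˡ
      ; distrib = comm∧distrʳ⇒distrˡ ⊗-comm ⊗-distribʳ-⊕ , ⊗-distribʳ-⊕ }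
    ; *-comm = ⊗-comm }

  ℤ[φ]-commutativeRing : CommutativeRing 0ℓ 0ℓ
  ℤ[φ]-commutativeRing = record { isCommutativeRing = ℤ[φ]-isCommutativeRing }

  -- The ring solver needs a zero test to cancel coefficients of ℤ[φ].
  ℤ[φ]-ring : AlmostCommutativeRing 0ℓ 0ℓ
  ℤ[φ]-ring = fromCommutativeRing ℤ[φ]-commutativeRing isZero
    where
    isZero : ∀ x → Maybe (𝟘 ≡ x)
    isZero ⟨ a , b ⟩ with 0ℤ ℤ.≟ a | 0ℤ ℤ.≟ b
    ... | yes a≡0 | yes b≡0 = just (cong₂ ⟨_,_⟩ a≡0 b≡0)
    ... | _       | _       = nothing

  open CommutativeRing ℤ[φ]-commutativeRing
    using (semiring; commutativeSemiring; +-monoid)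
  open CommutativeRing ℤ[φ]-commutativeRing public
    using () renaming (zeroˡ to ⊗-zeroˡ; +-identityʳ to ⊕-identityʳ; *-identityʳ to ⊗-identityʳ)
  open import Algebra.Properties.Semiring.Exp semiring public using (_^_; ^-homo-*; ^-assocʳ)
  open import Algebra.Properties.CommutativeSemiring.Exp commutativeSemiring public using (^-distrib-*)
  open import Algebra.Definitions.RawMonoid (CommutativeRing.+-rawMonoid ℤ[φ]-commutativeRing) using (sum) renaming (_×_ to _·_)
  open import Algebra.Properties.Monoid.Sum +-monoid using (sum-init-last)
  import Algebra.Properties.CommutativeSemiring.Binomial commutativeSemiring as Binomial

  𝟙^ : ∀ n → 𝟙 ^ n ≡ 𝟙
  𝟙^ zero = refl
  𝟙^ (suc n) = trans (cong (𝟙 ⊗_) (𝟙^ n)) (⊗-identityˡ 𝟙)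

  infix 4 _∣φ_
  _∣φ_ : ℤ → ℤ[φ] → Set
  q ∣φ ⟨ a , b ⟩ = q ∣ a × q ∣ b

  ∣0ℤ : ∀ {q} → q ∣ 0ℤ
  ∣0ℤ {q} = divides 0ℤ (sym (ℤ.*-zeroˡ q))

  ∣φ-𝟘 : ∀ {q} → q ∣φ 𝟘
  ∣φ-𝟘 = ∣0ℤ , ∣0ℤ

  ∣φ-⊕ : ∀ {q} x y → q ∣φ x → q ∣φ y → q ∣φ x ⊕ y
  ∣φ-⊕ ⟨ _ , _ ⟩ ⟨ _ , _ ⟩ (q∣a , q∣b) (q∣c , q∣d) = ∣m∣n⇒∣m+n q∣a q∣c , ∣m∣n⇒∣m+n q∣b q∣d

  ∣φ-⊖ : ∀ {q} x → q ∣φ x → q ∣φ ⊖ x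
  ∣φ-⊖ ⟨ _ , _ ⟩ (q∣a , q∣b) = ∣m⇒∣-m q∣a , ∣m⇒∣-m q∣b

  ∣φ-⊗ : ∀ {i j} x y → i ∣φ x → j ∣φ y → i * j ∣φ x ⊗ y
  ∣φ-⊗ {i} {j} ⟨ a , b ⟩ ⟨ c , d ⟩ (i∣a , i∣b) (j∣c , j∣d) =
    ∣m∣n⇒∣m+n (∣* i∣a j∣c) (∣* i∣b j∣d) ,
    ∣m∣n⇒∣m+n (∣m∣n⇒∣m+n (∣* i∣a j∣d) (∣* i∣b j∣c)) (∣* i∣b j∣d)
    where
    ∣* : ∀ {m n} → i ∣ m → j ∣ n → i * j ∣ m * n
    ∣* {m} i∣m j∣n = ∣-trans (*-monoˡ-∣ j i∣m) (*-monoʳ-∣ m j∣n)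

  ∣φ-⊗ˡ : ∀ {q} x y → q ∣φ y → q ∣φ x ⊗ y
  ∣φ-⊗ˡ ⟨ a , b ⟩ ⟨ c , d ⟩ (q∣c , q∣d) =
    ∣m∣n⇒∣m+n (∣n⇒∣m*n a q∣c) (∣n⇒∣m*n b q∣d) ,
    ∣m∣n⇒∣m+n (∣m∣n⇒∣m+n (∣n⇒∣m*n a q∣d) (∣n⇒∣m*n b q∣c)) (∣n⇒∣m*n b q∣d)

  ∣φ-⊗ʳ : ∀ {q} x y → q ∣φ x → q ∣φ x ⊗ y
  ∣φ-⊗ʳ x y q∣x = subst (_ ∣φ_) (⊗-comm y x) (∣φ-⊗ˡ y x q∣x)

  ∣φ-weaken : ∀ {q r} {x} → r ∣ q → q ∣φ x → r ∣φ x
  ∣φ-weaken {x = ⟨ _ , _ ⟩} r∣q (q∣a , q∣b) = ∣-trans r∣q q∣a , ∣-trans r∣q q∣b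

  ∣φ-ι : ∀ {q c} → q ∣ c → q ∣φ ι c
  ∣φ-ι q∣c = q∣c , ∣0ℤ

  infix 4 _≈_mod_
  record _≈_mod_ (x y : ℤ[φ]) (q : ℤ) : Set where
    constructor mk≈
    field difference : q ∣φ x ⊖ y
  open _≈_mod_ public

  module _ {q : ℤ} where

    ∣φ⇒≈𝟘 : ∀ {x} → q ∣φ x → x ≈ 𝟘 mod q
    ∣φ⇒≈𝟘 {x} q∣x = mk≈ (subst (q ∣φ_) (x≡x⊖𝟘 x) q∣x)
      where
      x≡x⊖𝟘 : ∀ x → x ≡ x ⊖ 𝟘
      x≡x⊖𝟘 = RingSolver.solve-∀ ℤ[φ]-ring

    ≈-refl : ∀ {x} → x ≈ x mod q
    ≈-refl {x} = mk≈ (subst (q ∣φ_) (𝟘≡x⊖x x) ∣φ-𝟘)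
      where
      𝟘≡x⊖x : ∀ x → 𝟘 ≡ x ⊖ x
      𝟘≡x⊖x = RingSolver.solve-∀ ℤ[φ]-ring

    ≈-reflexive : ∀ {x y} → x ≡ y → x ≈ y mod q
    ≈-reflexive refl = ≈-refl

    ≈-sym : ∀ {x y} → x ≈ y mod q → y ≈ x mod q
    ≈-sym {x} {y} (mk≈ q∣x-y) = mk≈ (subst (q ∣φ_) (negate x y) (∣φ-⊖ (x ⊖ y) q∣x-y))
      where
      negate : ∀ x y → ⊖ (x ⊖ y) ≡ y ⊖ x
      negate = RingSolver.solve-∀ ℤ[φ]-ring

    ≈-trans : ∀ {x y z} → x ≈ y mod q → y ≈ z mod q → x ≈ z mod q
    ≈-trans {x} {y} {z} (mk≈ q∣x-y) (mk≈ q∣y-z) =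
      mk≈ (subst (q ∣φ_) (telescope x y z) (∣φ-⊕ (x ⊖ y) (y ⊖ z) q∣x-y q∣y-z))
      where
      telescope : ∀ x y z → (x ⊖ y) ⊕ (y ⊖ z) ≡ x ⊖ z
      telescope = RingSolver.solve-∀ ℤ[φ]-ring

    ≈-isEquivalence : IsEquivalence (λ x y → x ≈ y mod q)
    ≈-isEquivalence = record { refl = ≈-refl ; sym = ≈-sym ; trans = ≈-trans }

    ⊕-cong : ∀ {x y z w} → x ≈ z mod q → y ≈ w mod q → x ⊕ y ≈ z ⊕ w mod q
    ⊕-cong {x} {y} {z} {w} (mk≈ q∣x-z) (mk≈ q∣y-w) =
      mk≈ (subst (q ∣φ_) (split x y z w) (∣φ-⊕ (x ⊖ z) (y ⊖ w) q∣x-z q∣y-w))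
      where
      split : ∀ x y z w → (x ⊖ z) ⊕ (y ⊖ w) ≡ (x ⊕ y) ⊖ (z ⊕ w)
      split = RingSolver.solve-∀ ℤ[φ]-ring

    ⊖-cong : ∀ {x y} → x ≈ y mod q → ⊖ x ≈ ⊖ y mod q
    ⊖-cong {x} {y} (mk≈ q∣x-y) = mk≈ (subst (q ∣φ_) (negate x y) (∣φ-⊖ (x ⊖ y) q∣x-y))
      where
      negate : ∀ x y → ⊖ (x ⊖ y) ≡ ⊖ x ⊖ ⊖ y
      negate = RingSolver.solve-∀ ℤ[φ]-ring

    ⊗-cong : ∀ {x y z w} → x ≈ z mod q → y ≈ w mod q → x ⊗ y ≈ z ⊗ w mod q
    ⊗-cong {x} {y} {z} {w} (mk≈ q∣x-z) (mk≈ q∣y-w) =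
      mk≈ (subst (q ∣φ_) (split x y z w)
        (∣φ-⊕ (x ⊗ (y ⊖ w)) (w ⊗ (x ⊖ z)) (∣φ-⊗ˡ x _ q∣y-w) (∣φ-⊗ˡ w _ q∣x-z)))
      where
      split : ∀ x y z w → x ⊗ (y ⊖ w) ⊕ w ⊗ (x ⊖ z) ≡ x ⊗ y ⊖ z ⊗ w
      split = RingSolver.solve-∀ ℤ[φ]-ring

    x⊕y≈x : ∀ x {y} → y ≈ 𝟘 mod q → x ⊕ y ≈ x mod q
    x⊕y≈x x {y} y≈𝟘 = ≈-trans (⊕-cong ≈-refl y≈𝟘) (≈-reflexive (⊕-identityʳ x))

    ^-congˡ : ∀ {x y} → x ≈ y mod q → ∀ n → x ^ n ≈ y ^ n mod q
    ^-congˡ x≈y zero = ≈-refl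
    ^-congˡ x≈y (suc n) = ⊗-cong x≈y (^-congˡ x≈y n)

  ℤ[φ]/_ : ℤ → Setoid 0ℓ 0ℓ
  ℤ[φ]/ q = record { isEquivalence = ≈-isEquivalence {q} }

  module ≈-Reasoning (q : ℤ) = Relation.Binary.Reasoning.Setoid (ℤ[φ]/ q)

  𝟘^ : ∀ n → .{{ℕ.NonZero n}} → 𝟘 ^ n ≡ 𝟘
  𝟘^ (suc n) = ⊗-zeroˡ (𝟘 ^ n)

  ·≡ι⊗ : ∀ n x → n · x ≡ ι (+ n) ⊗ x
  ·≡ι⊗ zero x = sym (⊗-zeroˡ x)
  ·≡ι⊗ (suc n) x = begin
    x ⊕ n · x           ≡⟨ cong₂ _⊕_ (sym (⊗-identityˡ x)) (·≡ι⊗ n x) ⟩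
    𝟙 ⊗ x ⊕ ι (+ n) ⊗ x ≡⟨ ⊗-distribʳ-⊕ x 𝟙 (ι (+ n)) ⟨
    ι (+ suc n) ⊗ x    ∎
    where open ≡-Reasoning

  ∣φ-sum : ∀ {q n} (v : Fin n → ℤ[φ]) → (∀ i → q ∣φ v i) → q ∣φ sum v
  ∣φ-sum {n = zero} v q∣v = ∣φ-𝟘
  ∣φ-sum {n = suc n} v q∣v = ∣φ-⊕ (v Fin.zero) (sum (tail v)) (q∣v Fin.zero) (∣φ-sum (tail v) (q∣v ∘ Fin.suc))

  frobenius : ∀ {p} → Prime p → ∀ x y → (x ⊕ y) ^ p ≈ x ^ p ⊕ y ^ p mod + p
  frobenius {zero} p-prime = contradiction (prime>1 p-prime) λ ()
  frobenius {suc n} p-prime x y = begin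
    (x ⊕ y) ^ p                          ≡⟨ Binomial.theorem p x y ⟩
    sum terms                            ≡⟨ cong₂ _⊕_ first (trans (sum-init-last (tail terms)) (cong (inner ⊕_) final)) ⟩
    y ^ p ⊕ (inner ⊕ x ^ p)              ≈⟨ ⊕-cong ≈-refl (⊕-cong (∣φ⇒≈𝟘 inner-divisible) ≈-refl) ⟩
    y ^ p ⊕ (𝟘 ⊕ x ^ p)                  ≡⟨ rearrange (x ^ p) (y ^ p) ⟩
    x ^ p ⊕ y ^ p                        ∎
    where
    open ≈-Reasoning (+ suc n)
    p = suc n
    terms = Binomial.binomialTerm x y p
    inner = sum (init (tail terms))
    first : terms Fin.zero ≡ y ^ p
    first = trans (⊕-identityʳ _) (⊗-identityˡ _)
    final : last (tail terms) ≡ x ^ p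
    final rewrite Fin.toℕ-fromℕ n | nCn≡1 p | ℕ.n∸n≡0 n = trans (⊕-identityʳ _) (⊗-identityʳ _)
    inner-divisible : + p ∣φ inner
    inner-divisible = ∣φ-sum _ λ i → let k = toℕ (inject₁ i) in
      subst (+ p ∣φ_) (sym (·≡ι⊗ (p C suc k) _))
        (∣φ-⊗ʳ _ (Binomial.binomial x y p (Fin.suc (inject₁ i))) (∣φ-ι (∣ᵤ⇒∣ (prime∣pC[1+k] p-prime
          (subst (ℕ._< n) (sym (Fin.toℕ-inject₁ i)) (Fin.toℕ<n i))))))
    rearrange : ∀ a b → b ⊕ (𝟘 ⊕ a) ≡ a ⊕ b
    rearrange = RingSolver.solve-∀ ℤ[φ]-ring

  module _ {p} (p-prime : Prime p) where

    private
      instance _ = prime⇒nonZero p-prime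
      𝟘^p≡𝟘 : 𝟘 ^ p ≡ 𝟘
      𝟘^p≡𝟘 = 𝟘^ p

    frobenius-⊖ : ∀ x → (⊖ x) ^ p ≈ ⊖ (x ^ p) mod + p
    frobenius-⊖ x = begin
      (⊖ x) ^ p                         ≡⟨ cancel (x ^ p) ((⊖ x) ^ p) ⟩
      ⊖ (x ^ p) ⊕ (x ^ p ⊕ (⊖ x) ^ p)   ≈⟨ ⊕-cong ≈-refl (frobenius p-prime x (⊖ x)) ⟨
      ⊖ (x ^ p) ⊕ (x ⊖ x) ^ p           ≡⟨ cong (λ z → ⊖ (x ^ p) ⊕ z ^ p) (x⊖x≡𝟘 x) ⟩
      ⊖ (x ^ p) ⊕ 𝟘 ^ p                 ≡⟨ cong (⊖ (x ^ p) ⊕_) 𝟘^p≡𝟘 ⟩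
      ⊖ (x ^ p) ⊕ 𝟘                     ≡⟨ ⊕-identityʳ _ ⟩
      ⊖ (x ^ p)                         ∎
      where
      open ≈-Reasoning (+ p)
      cancel : ∀ a b → b ≡ ⊖ a ⊕ (a ⊕ b)
      cancel = RingSolver.solve-∀ ℤ[φ]-ring
      x⊖x≡𝟘 : ∀ x → x ⊖ x ≡ 𝟘
      x⊖x≡𝟘 = RingSolver.solve-∀ ℤ[φ]-ring

    fermat-ℕ : ∀ m → ι (+ m) ^ p ≈ ι (+ m) mod + p
    fermat-ℕ zero = ≈-reflexive 𝟘^p≡𝟘
    fermat-ℕ (suc m) = begin
      (𝟙 ⊕ ι (+ m)) ^ p       ≈⟨ frobenius p-prime 𝟙 (ι (+ m)) ⟩
      𝟙 ^ p ⊕ ι (+ m) ^ p     ≈⟨ ⊕-cong (≈-reflexive (𝟙^ p)) (fermat-ℕ m) ⟩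
      𝟙 ⊕ ι (+ m)             ∎
      where open ≈-Reasoning (+ p)

    fermat : ∀ c → ι c ^ p ≈ ι c mod + p
    fermat (+ m) = fermat-ℕ m
    fermat -[1+ m ] = ≈-trans (frobenius-⊖ (ι (+ suc m))) (⊖-cong (fermat-ℕ (suc m)))

  geometric : ℤ[φ] → ℕ → ℤ[φ]
  geometric x zero = 𝟘
  geometric x (suc n) = x ⊗ geometric x n ⊕ 𝟙

  ^⊖𝟙≡⊖𝟙⊗geometric : ∀ x n → x ^ n ⊖ 𝟙 ≡ (x ⊖ 𝟙) ⊗ geometric x n
  ^⊖𝟙≡⊖𝟙⊗geometric x zero = RingSolver.solve (x ∷ []) ℤ[φ]-ring
  ^⊖𝟙≡⊖𝟙⊗geometric x (suc n) = begin
    x ⊗ x ^ n ⊖ 𝟙                              ≡⟨ step₁ x (x ^ n) ⟩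
    x ⊗ (x ^ n ⊖ 𝟙) ⊕ (x ⊖ 𝟙)                  ≡⟨ cong (λ z → x ⊗ z ⊕ (x ⊖ 𝟙)) (^⊖𝟙≡⊖𝟙⊗geometric x n) ⟩
    x ⊗ ((x ⊖ 𝟙) ⊗ geometric x n) ⊕ (x ⊖ 𝟙)    ≡⟨ step₂ x (geometric x n) ⟩
    (x ⊖ 𝟙) ⊗ (x ⊗ geometric x n ⊕ 𝟙)          ∎
    where
    open ≡-Reasoning
    step₁ : ∀ x y → x ⊗ y ⊖ 𝟙 ≡ x ⊗ (y ⊖ 𝟙) ⊕ (x ⊖ 𝟙)
    step₁ = RingSolver.solve-∀ ℤ[φ]-ring
    step₂ : ∀ x g → x ⊗ ((x ⊖ 𝟙) ⊗ g) ⊕ (x ⊖ 𝟙) ≡ (x ⊖ 𝟙) ⊗ (x ⊗ g ⊕ 𝟙)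
    step₂ = RingSolver.solve-∀ ℤ[φ]-ring

  geometric-cong : ∀ {q x} → x ≈ 𝟙 mod q → ∀ n → geometric x n ≈ ι (+ n) mod q
  geometric-cong x≈𝟙 zero = ≈-refl
  geometric-cong {q} {x} x≈𝟙 (suc n) = begin
    x ⊗ geometric x n ⊕ 𝟙   ≈⟨ ⊕-cong (⊗-cong x≈𝟙 (geometric-cong x≈𝟙 n)) ≈-refl ⟩
    𝟙 ⊗ ι (+ n) ⊕ 𝟙         ≡⟨ cong (_⊕ 𝟙) (⊗-identityˡ (ι (+ n))) ⟩
    ι (+ n) ⊕ 𝟙             ≡⟨ ⊕-comm (ι (+ n)) 𝟙 ⟩
    ι (+ suc n)             ∎
    where open ≈-Reasoning q

  ^-lift : ∀ {q} p {x} → + p ∣ q → x ≈ 𝟙 mod q → x ^ p ≈ 𝟙 mod q * + p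
  ^-lift {q} p {x} p∣q x≈𝟙@(mk≈ q∣x-𝟙) = mk≈ (subst (q * + p ∣φ_) (sym x^p⊖𝟙≡) (∣φ-⊕ _ _ big small))
    where
    g = geometric x p
    x^p⊖𝟙≡ : x ^ p ⊖ 𝟙 ≡ (x ⊖ 𝟙) ⊗ (g ⊖ ι (+ p)) ⊕ (x ⊖ 𝟙) ⊗ ι (+ p)
    x^p⊖𝟙≡ = trans (^⊖𝟙≡⊖𝟙⊗geometric x p) (split (x ⊖ 𝟙) g (ι (+ p)))
      where
      split : ∀ a g c → a ⊗ g ≡ a ⊗ (g ⊖ c) ⊕ a ⊗ c
      split = RingSolver.solve-∀ ℤ[φ]-ring
    big : q * + p ∣φ (x ⊖ 𝟙) ⊗ (g ⊖ ι (+ p))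
    big = ∣φ-weaken (*-monoʳ-∣ q p∣q) (∣φ-⊗ _ _ q∣x-𝟙 (difference (geometric-cong x≈𝟙 p)))
    small : q * + p ∣φ (x ⊖ 𝟙) ⊗ ι (+ p)
    small = ∣φ-⊗ _ _ q∣x-𝟙 (∣φ-ι ∣-refl)

  module _ {x : ℤ[φ]} {L p : ℕ} (x^L≈𝟙 : x ^ L ≈ 𝟙 mod + p) where

    ^-lift-power : ∀ k → x ^ (L ℕ.* p ℕ.^ k) ≈ 𝟙 mod + (p ℕ.^ suc k)
    ^-lift-power zero = subst₂ (λ e q → x ^ e ≈ 𝟙 mod + q) (sym (ℕ.*-identityʳ L)) (sym (ℕ.*-identityʳ p)) x^L≈𝟙
    ^-lift-power (suc k) = subst₂ (λ y q → y ≈ 𝟙 mod q) exponent modulus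
      (^-lift p (divides (+ (p ℕ.^ k)) (trans (cong +_ (ℕ.*-comm p (p ℕ.^ k))) (ℤ.pos-* (p ℕ.^ k) p)))
        (^-lift-power k))
      where
      exponent : (x ^ (L ℕ.* p ℕ.^ k)) ^ p ≡ x ^ (L ℕ.* p ℕ.^ suc k)
      exponent = trans (^-assocʳ x (L ℕ.* p ℕ.^ k) p) (cong (x ^_) (reassoc L p (p ℕ.^ k)))
        where
        reassoc : ∀ a b c → a ℕ.* c ℕ.* b ≡ a ℕ.* (b ℕ.* c)
        reassoc = ℕ-Solver.solve-∀
      modulus : + (p ℕ.^ suc k) * + p ≡ + (p ℕ.^ suc (suc k))
      modulus = trans (sym (ℤ.pos-* (p ℕ.^ suc k) p)) (cong +_ (ℕ.*-comm (p ℕ.^ suc k) p))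

  ^-periodic : ∀ {x q L} → x ^ L ≈ 𝟙 mod q → ∀ a s → x ^ (a ℕ.+ L ℕ.* s) ≈ x ^ a mod q
  ^-periodic {x} {q} {L} x^L≈𝟙 a s = begin
    x ^ (a ℕ.+ L ℕ.* s)       ≡⟨ ^-homo-* x a (L ℕ.* s) ⟩
    x ^ a ⊗ x ^ (L ℕ.* s)     ≡⟨ cong (x ^ a ⊗_) (^-assocʳ x L s) ⟨
    x ^ a ⊗ (x ^ L) ^ s       ≈⟨ ⊗-cong ≈-refl (^-congˡ x^L≈𝟙 s) ⟩
    x ^ a ⊗ 𝟙 ^ s             ≡⟨ cong (x ^ a ⊗_) (𝟙^ s) ⟩
    x ^ a ⊗ 𝟙                 ≡⟨ ⊗-identityʳ (x ^ a) ⟩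
    x ^ a                     ∎
    where open ≈-Reasoning q

module FibonacciSquares where

  open import Data.Integer as ℤ using (ℤ; +_; -_; _+_; _*_; _-_; 0ℤ; 1ℤ)
  import Data.Integer.Properties as ℤ
  open import Data.Integer.Divisibility.Signed
  open import Data.Integer.Tactic.RingSolver using (solve-∀)
  open import Data.Nat as ℕ using (ℕ; zero; suc; _≤_; z≤n; s≤s)
  import Data.Nat.Properties as ℕ
  import Data.Nat.Divisibility as ℕ
  open import Data.Nat.DivMod using (_%_; [m+kn]%n≡m%n)
  open import Data.Nat.Primality using (Prime; prime?; euclidsLemma; prime⇒irreducible; prime⇒nonZero)
  import Data.Nat.Tactic.RingSolver as ℕ-Solver
  open import Data.Product using (Σ-syntax; _,_; proj₁; uncurry)
  open import Data.Sum as Sum using (_⊎_; inj₁; inj₂; [_,_]′)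
  open import Function using (id; _∘_)
  open import Relation.Binary.PropositionalEquality
  open import Relation.Nullary using (¬_; yes; no; contradiction)
  open import Relation.Nullary.Decidable using (from-yes)
  import Tactic.RingSolver as RingSolver

  open import Defs using (fib; Realizable)
  open Sums
  open PrimePowers using (prime>1)
  open DoldCriterion using (Superincreasing; DoldCongruences)
  open OrbitCounting using (realizable⇒U[p]≡U[1])
  open GoldenIntegers

  φ-part : ℤ[φ] → ℤ
  φ-part ⟨ _ , b ⟩ = b

  φ^[1+n] : ∀ n → φ ^ suc n ≡ ⟨ + fib n , + fib (suc n) ⟩
  φ^[1+n] zero = refl
  φ^[1+n] (suc n) = trans (cong (φ ⊗_) (φ^[1+n] n))
    (cong₂ ⟨_,_⟩ (re (+ fib n) (+ fib (suc n))) (trans (im (+ fib n) (+ fib (suc n))) (sym (ℤ.pos-+ (fib (suc n)) (fib n)))))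
    where
    re : ∀ a b → 0ℤ * a + 1ℤ * b ≡ b
    re = solve-∀
    im : ∀ a b → 0ℤ * b + 1ℤ * a + 1ℤ * b ≡ b + a
    im = solve-∀

  φ-part-φ^ : ∀ n → φ-part (φ ^ n) ≡ + fib n
  φ-part-φ^ zero = refl
  φ-part-φ^ (suc n) = cong φ-part (φ^[1+n] n)

  ∣φ⇒∣φ-part : ∀ {q} x → q ∣φ x → q ∣ φ-part x
  ∣φ⇒∣φ-part ⟨ _ , _ ⟩ (_ , q∣b) = q∣b

  φ-part-⊖ : ∀ x y → φ-part (x ⊖ y) ≡ φ-part x - φ-part y
  φ-part-⊖ ⟨ _ , _ ⟩ ⟨ _ , _ ⟩ = refl

  fib-cong : ∀ {q a b} → φ ^ a ≈ φ ^ b mod q → q ∣ + fib a - + fib b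
  fib-cong {q} {a} {b} (mk≈ q∣φ^a-φ^b) =
    subst (q ∣_) (trans (φ-part-⊖ (φ ^ a) (φ ^ b)) (cong₂ _-_ (φ-part-φ^ a) (φ-part-φ^ b)))
      (∣φ⇒∣φ-part (φ ^ a ⊖ φ ^ b) q∣φ^a-φ^b)

  fib-periodic : ∀ {q L} → φ ^ L ≈ 𝟙 mod q → ∀ a s → q ∣ + fib (a ℕ.+ L ℕ.* s) - + fib a
  fib-periodic {L = L} φ^L≈𝟙 a s = fib-cong {a = a ℕ.+ L ℕ.* s} {b = a} (^-periodic {x = φ} {L = L} φ^L≈𝟙 a s)

  module _ {p} (p-prime : Prime p) where

    ℤ-euclid : ∀ a b → + p ∣ a * b → + p ∣ a ⊎ + p ∣ b
    ℤ-euclid a b p∣ab with euclidsLemma ℤ.∣ a ∣ ℤ.∣ b ∣ p-prime (subst (p ℕ.∣_) (ℤ.abs-* a b) (∣⇒∣ᵤ p∣ab))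
    ... | inj₁ p∣a = inj₁ (∣ᵤ⇒∣ p∣a)
    ... | inj₂ p∣b = inj₂ (∣ᵤ⇒∣ p∣b)

    ∣^⇒∣ : ∀ a k → + p ∣ a ℤ.^ k → + p ∣ a
    ∣^⇒∣ a zero p∣1 = contradiction (ℕ.∣⇒≤ (∣⇒∣ᵤ p∣1)) (ℕ.<⇒≱ (prime>1 p-prime))
    ∣^⇒∣ a (suc k) p∣a^[1+k] with ℤ-euclid a (a ℤ.^ k) p∣a^[1+k]
    ... | inj₁ p∣a = p∣a
    ... | inj₂ p∣a^k = ∣^⇒∣ a k p∣a^k

  ι-^ : ∀ a k → ι a ^ k ≡ ι (a ℤ.^ k)
  ι-^ a zero = refl
  ι-^ a (suc k) = trans (cong (ι a ⊗_) (ι-^ a k)) (cong₂ ⟨_,_⟩ (re a (a ℤ.^ k)) (im a (a ℤ.^ k)))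
    where
    re : ∀ a b → a * b + 0ℤ * 0ℤ ≡ a * b
    re = solve-∀
    im : ∀ a b → a * 0ℤ + 0ℤ * b + 0ℤ * 0ℤ ≡ 0ℤ
    im = solve-∀

  module _ {p} (p-prime : Prime p) (p∤5 : ¬ + p ∣ + 5) where

    private
      im≡d*s : ∀ c d → c * d + d * c + d * d + - (d + 0ℤ) ≡ d * (c + c + d - 1ℤ)
      im≡d*s = solve-∀
      five-c[c-1] : ∀ c d → + 5 * (c * (c - 1ℤ)) ≡ (c * c + d * d + - (c + 1ℤ)) - (c + c + d - 1ℤ) * (d - c - c + 1ℤ)
      five-c[c-1] = solve-∀
      d-1 : ∀ c d → d + - 1ℤ ≡ (c + c + d - 1ℤ) - (c + c)
      d-1 = solve-∀
      d+1 : ∀ c d → d + 1ℤ ≡ (c + c + d - 1ℤ) - ((c - 1ℤ) + (c - 1ℤ))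
      d+1 = solve-∀

      root-ι : ∀ c d → + p ∣ d → ⟨ c , d ⟩ ≈ ι c mod + p
      root-ι c d p∣d = mk≈ (subst (+ p ∣_) (sym (ℤ.+-inverseʳ c)) ∣0ℤ , subst (+ p ∣_) (sym (ℤ.+-identityʳ d)) p∣d)

      root-φ : ∀ c d → + p ∣ c → + p ∣ c + c + d - 1ℤ → ⟨ c , d ⟩ ≈ φ mod + p
      root-φ c d p∣c p∣s = mk≈ (subst (+ p ∣_) (sym (ℤ.+-identityʳ c)) p∣c ,
                                subst (+ p ∣_) (sym (d-1 c d)) (∣m∣n⇒∣m-n p∣s (∣m∣n⇒∣m+n p∣c p∣c)))

      root-𝟙⊖φ : ∀ c d → + p ∣ c - 1ℤ → + p ∣ c + c + d - 1ℤ → ⟨ c , d ⟩ ≈ 𝟙 ⊖ φ mod + p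
      root-𝟙⊖φ c d p∣c-1 p∣s =
        mk≈ (p∣c-1 , subst (+ p ∣_) (sym (d+1 c d)) (∣m∣n⇒∣m-n p∣s (∣m∣n⇒∣m+n p∣c-1 p∣c-1)))

      p∣c[c-1] : ∀ c d → + p ∣ c * c + d * d + - (c + 1ℤ) → + p ∣ c + c + d - 1ℤ → + p ∣ c * (c - 1ℤ)
      p∣c[c-1] c d p∣re p∣s = [ (λ p∣5 → contradiction p∣5 p∤5) , id ]′ (ℤ-euclid p-prime (+ 5) (c * (c - 1ℤ)) p∣5c[c-1])
        where
        p∣5c[c-1] : + p ∣ + 5 * (c * (c - 1ℤ))
        p∣5c[c-1] = subst (+ p ∣_) (sym (five-c[c-1] c d)) (∣m∣n⇒∣m-n p∣re (∣m⇒∣m*n (d - c - c + 1ℤ) p∣s))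

    -- For y = c + d φ, y² ≡ y + 1 reads c² + d² ≡ c + 1 and d (2c + d − 1) ≡ 0; if p ∤ d then 5 c (c − 1) ≡ 0.
    roots-of-x²-x-1 : ∀ y → y ⊗ y ≈ y ⊕ 𝟙 mod + p →
                      (Σ[ c ∈ ℤ ] y ≈ ι c mod + p) ⊎ y ≈ φ mod + p ⊎ y ≈ 𝟙 ⊖ φ mod + p
    roots-of-x²-x-1 ⟨ c , d ⟩ (mk≈ (p∣re , p∣im)) =
      [ (λ p∣d → inj₁ (c , root-ι c d p∣d))
      , (λ p∣s → inj₂ (Sum.map (λ p∣c → root-φ c d p∣c p∣s) (λ p∣c-1 → root-𝟙⊖φ c d p∣c-1 p∣s)
                               (ℤ-euclid p-prime c (c - 1ℤ) (p∣c[c-1] c d p∣re p∣s))))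
      ]′ (ℤ-euclid p-prime d (c + c + d - 1ℤ) (subst (+ p ∣_) (im≡d*s c d) p∣im))

    φ^p⊗φ^p≈φ^p⊕𝟙 : φ ^ p ⊗ φ ^ p ≈ φ ^ p ⊕ 𝟙 mod + p
    φ^p⊗φ^p≈φ^p⊕𝟙 = begin
      φ ^ p ⊗ φ ^ p     ≡⟨ ^-distrib-* φ φ p ⟨
      (φ ⊕ 𝟙) ^ p       ≈⟨ frobenius p-prime φ 𝟙 ⟩
      φ ^ p ⊕ 𝟙 ^ p     ≡⟨ cong (φ ^ p ⊕_) (𝟙^ p) ⟩
      φ ^ p ⊕ 𝟙         ∎
      where open ≈-Reasoning (+ p)

    -- With u = φ − c and e = 1 − 2c: u² ≡ e u and e² ≡ 5, so u ^ p ≡ 0 forces p ∣ e and hence p ∣ 5.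
    module _ (c : ℤ) (φ^p≈C : φ ^ p ≈ ι c mod + p) where

      private
        C u e : ℤ[φ]
        C = ι c
        u = φ ⊖ C
        e = 𝟙 ⊖ C ⊖ C
        n = ℕ.pred p
        p≡1+n : p ≡ suc n
        p≡1+n = sym (ℕ.suc-pred p {{prime⇒nonZero p-prime}})
        open ≈-Reasoning (+ p)

      C⊗C≈C⊕𝟙 : C ⊗ C ≈ C ⊕ 𝟙 mod + p
      C⊗C≈C⊕𝟙 = begin
        C ⊗ C             ≈⟨ ⊗-cong φ^p≈C φ^p≈C ⟨
        φ ^ p ⊗ φ ^ p     ≈⟨ φ^p⊗φ^p≈φ^p⊕𝟙 ⟩
        φ ^ p ⊕ 𝟙         ≈⟨ ⊕-cong φ^p≈C ≈-refl ⟩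
        C ⊕ 𝟙             ∎

      u⊗u≈e⊗u : u ⊗ u ≈ e ⊗ u mod + p
      u⊗u≈e⊗u = begin
        u ⊗ u                                         ≡⟨ expand φ C ⟩
        e ⊗ u ⊕ ((φ ⊗ φ ⊖ φ ⊖ 𝟙) ⊕ (C ⊕ 𝟙 ⊖ C ⊗ C))   ≈⟨ x⊕y≈x (e ⊗ u) (∣φ⇒≈𝟘 p∣rest) ⟩
        e ⊗ u                                         ∎
        where
        p∣rest : + p ∣φ (φ ⊗ φ ⊖ φ ⊖ 𝟙) ⊕ (C ⊕ 𝟙 ⊖ C ⊗ C)
        p∣rest = ∣φ-⊕ (φ ⊗ φ ⊖ φ ⊖ 𝟙) _ ∣φ-𝟘 (difference (≈-sym C⊗C≈C⊕𝟙))
        expand : ∀ f C → (f ⊖ C) ⊗ (f ⊖ C)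
                       ≡ (𝟙 ⊖ C ⊖ C) ⊗ (f ⊖ C) ⊕ ((f ⊗ f ⊖ f ⊖ 𝟙) ⊕ (C ⊕ 𝟙 ⊖ C ⊗ C))
        expand = RingSolver.solve-∀ ℤ[φ]-ring

      u^[1+k]≈e^k⊗u : ∀ k → u ^ suc k ≈ e ^ k ⊗ u mod + p
      u^[1+k]≈e^k⊗u zero = ≈-reflexive (⊗-comm u 𝟙)
      u^[1+k]≈e^k⊗u (suc k) = begin
        u ⊗ u ^ suc k          ≈⟨ ⊗-cong ≈-refl (u^[1+k]≈e^k⊗u k) ⟩
        u ⊗ (e ^ k ⊗ u)        ≡⟨ swap u (e ^ k) ⟩
        e ^ k ⊗ (u ⊗ u)        ≈⟨ ⊗-cong ≈-refl u⊗u≈e⊗u ⟩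
        e ^ k ⊗ (e ⊗ u)        ≡⟨ ⊗-assoc (e ^ k) e u ⟨
        e ^ k ⊗ e ⊗ u          ≡⟨ cong (_⊗ u) (⊗-comm (e ^ k) e) ⟩
        e ^ suc k ⊗ u          ∎
        where
        swap : ∀ u w → u ⊗ (w ⊗ u) ≡ w ⊗ (u ⊗ u)
        swap = RingSolver.solve-∀ ℤ[φ]-ring

      u^p≈𝟘 : u ^ p ≈ 𝟘 mod + p
      u^p≈𝟘 = begin
        (φ ⊕ ⊖ C) ^ p       ≈⟨ frobenius p-prime φ (⊖ C) ⟩
        φ ^ p ⊕ (⊖ C) ^ p   ≈⟨ ⊕-cong φ^p≈C (frobenius-⊖ p-prime C) ⟩
        C ⊕ ⊖ (C ^ p)       ≈⟨ ⊕-cong ≈-refl (⊖-cong (fermat p-prime c)) ⟩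
        C ⊖ C               ≡⟨ cong₂ ⟨_,_⟩ (ℤ.+-inverseʳ c) refl ⟩
        𝟘                   ∎

      p∣e^n : + p ∣ (1ℤ - c - c) ℤ.^ n
      p∣e^n = subst (+ p ∣_) (φ-part≡ ((1ℤ - c - c) ℤ.^ n) c) (∣φ⇒∣φ-part _ (difference e^n⊗u≈𝟘))
        where
        e^n⊗u≈𝟘 : ι ((1ℤ - c - c) ℤ.^ n) ⊗ u ≈ 𝟘 mod + p
        e^n⊗u≈𝟘 = begin
          ι ((1ℤ - c - c) ℤ.^ n) ⊗ u   ≡⟨ cong (_⊗ u) (ι-^ (1ℤ - c - c) n) ⟨
          e ^ n ⊗ u                    ≈⟨ u^[1+k]≈e^k⊗u n ⟨
          u ^ suc n                    ≡⟨ cong (u ^_) p≡1+n ⟨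
          u ^ p                        ≈⟨ u^p≈𝟘 ⟩
          𝟘                            ∎
        φ-part≡ : ∀ a c → a * 1ℤ + 0ℤ * (0ℤ + - c) + 0ℤ * 1ℤ + - 0ℤ ≡ a
        φ-part≡ = solve-∀

      e≈𝟘 : e ≈ 𝟘 mod + p
      e≈𝟘 = ∣φ⇒≈𝟘 (∣φ-ι (∣^⇒∣ p-prime (1ℤ - c - c) n p∣e^n))

      5≈𝟘 : ι (+ 5) ≈ 𝟘 mod + p
      5≈𝟘 = begin
        five                                  ≈⟨ x⊕y≈x five (∣φ⇒≈𝟘 (∣φ-⊗ˡ four _ (difference C⊗C≈C⊕𝟙))) ⟨
        five ⊕ four ⊗ (C ⊗ C ⊖ (C ⊕ 𝟙))       ≡⟨ square C ⟨
        e ⊗ e                                 ≈⟨ ⊗-cong e≈𝟘 e≈𝟘 ⟩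
        𝟘 ⊗ 𝟘                                 ≡⟨ ⊗-zeroˡ 𝟘 ⟩
        𝟘                                     ∎
        where
        four five : ℤ[φ]
        four = 𝟙 ⊕ 𝟙 ⊕ 𝟙 ⊕ 𝟙
        five = four ⊕ 𝟙
        square : ∀ C → (𝟙 ⊖ C ⊖ C) ⊗ (𝟙 ⊖ C ⊖ C)
                     ≡ (𝟙 ⊕ 𝟙 ⊕ 𝟙 ⊕ 𝟙 ⊕ 𝟙) ⊕ (𝟙 ⊕ 𝟙 ⊕ 𝟙 ⊕ 𝟙) ⊗ (C ⊗ C ⊖ (C ⊕ 𝟙))
        square = RingSolver.solve-∀ ℤ[φ]-ring

    φ^p≉ι : ∀ c → ¬ φ ^ p ≈ ι c mod + p
    φ^p≉ι c φ^p≈C = p∤5 (subst (+ p ∣_) (ℤ.+-identityʳ (+ 5)) (proj₁ (difference (5≈𝟘 c φ^p≈C))))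

    -- φ ^ p is a root of x² − x − 1, so it is φ or its conjugate 1 − φ; applying Frobenius again gives φ.
    φ^[p*p]≈φ : φ ^ (p ℕ.* p) ≈ φ mod + p
    φ^[p*p]≈φ = [ (λ (c , φ^p≈c) → contradiction φ^p≈c (φ^p≉ι c)) , [ fixed , conjugate ]′ ]′
                  (roots-of-x²-x-1 (φ ^ p) φ^p⊗φ^p≈φ^p⊕𝟙)
      where
      open ≈-Reasoning (+ p)
      fixed : φ ^ p ≈ φ mod + p → φ ^ (p ℕ.* p) ≈ φ mod + p
      fixed φ^p≈φ = begin
        φ ^ (p ℕ.* p)     ≡⟨ ^-assocʳ φ p p ⟨
        (φ ^ p) ^ p       ≈⟨ ^-congˡ φ^p≈φ p ⟩
        φ ^ p             ≈⟨ φ^p≈φ ⟩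
        φ                 ∎
      conjugate : φ ^ p ≈ 𝟙 ⊖ φ mod + p → φ ^ (p ℕ.* p) ≈ φ mod + p
      conjugate φ^p≈𝟙⊖φ = begin
        φ ^ (p ℕ.* p)       ≡⟨ ^-assocʳ φ p p ⟨
        (φ ^ p) ^ p         ≈⟨ ^-congˡ φ^p≈𝟙⊖φ p ⟩
        (𝟙 ⊕ ⊖ φ) ^ p       ≈⟨ frobenius p-prime 𝟙 (⊖ φ) ⟩
        𝟙 ^ p ⊕ (⊖ φ) ^ p   ≈⟨ ⊕-cong (≈-reflexive (𝟙^ p)) (frobenius-⊖ p-prime φ) ⟩
        𝟙 ⊖ φ ^ p           ≈⟨ ⊕-cong ≈-refl (⊖-cong φ^p≈𝟙⊖φ) ⟩
        𝟙 ⊖ (𝟙 ⊖ φ)         ≡⟨⟩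
        φ                   ∎

    φ^[p*p∸1]≈𝟙 : φ ^ (p ℕ.* p ℕ.∸ 1) ≈ 𝟙 mod + p
    φ^[p*p∸1]≈𝟙 = begin
      φ ^ L                       ≡⟨ ⊗-identityˡ (φ ^ L) ⟨
      (φ ⊖ 𝟙) ⊗ φ ⊗ φ ^ L         ≡⟨ ⊗-assoc (φ ⊖ 𝟙) φ (φ ^ L) ⟩
      (φ ⊖ 𝟙) ⊗ φ ^ suc L         ≡⟨ cong (λ k → (φ ⊖ 𝟙) ⊗ φ ^ k) (ℕ.suc-pred (p ℕ.* p) {{p*p≢0}}) ⟩
      (φ ⊖ 𝟙) ⊗ φ ^ (p ℕ.* p)     ≈⟨ ⊗-cong ≈-refl φ^[p*p]≈φ ⟩
      (φ ⊖ 𝟙) ⊗ φ                 ≡⟨⟩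
      𝟙                           ∎
      where
      open ≈-Reasoning (+ p)
      L = p ℕ.* p ℕ.∸ 1
      p*p≢0 = ℕ.m*n≢0 p p {{prime⇒nonZero p-prime}} {{prime⇒nonZero p-prime}}


  fib-≤-suc : ∀ n → fib n ≤ fib (suc n)
  fib-≤-suc zero = z≤n
  fib-≤-suc (suc zero) = ℕ.≤-refl
  fib-≤-suc (suc (suc n)) = ℕ.m≤m+n (fib (suc (suc n))) (fib (suc n))

  fib-mono : ∀ {a} b → a ≤ b → fib a ≤ fib b
  fib-mono zero z≤n = ℕ.≤-refl
  fib-mono (suc b) a≤1+b with ℕ.m≤n⇒m<n∨m≡n a≤1+b
  ... | inj₂ refl = ℕ.≤-refl
  ... | inj₁ (s≤s a≤b) = ℕ.≤-trans (fib-mono b a≤b) (fib-≤-suc b)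

  fib[n²]-superincreasing : ∀ k → ∑< k (λ j → fib (suc j ℕ.* suc j)) ≤ fib (suc k ℕ.* suc k)
  fib[n²]-superincreasing zero = z≤n
  fib[n²]-superincreasing (suc k) = begin
    ∑< k (λ j → fib (suc j ℕ.* suc j)) ℕ.+ fib a   ≤⟨ ℕ.+-monoˡ-≤ (fib a) (fib[n²]-superincreasing k) ⟩
    fib a ℕ.+ fib a                                ≤⟨ ℕ.+-monoˡ-≤ (fib a) (fib-≤-suc a) ⟩
    fib (suc (suc a))                              ≤⟨ fib-mono (suc (suc k) ℕ.* suc (suc k)) a+2≤[k+2]² ⟩
    fib (suc (suc k) ℕ.* suc (suc k))              ∎
    where
    open ℕ.≤-Reasoning
    a = suc k ℕ.* suc k
    a+2≤[k+2]² : suc (suc a) ≤ suc (suc k) ℕ.* suc (suc k)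
    a+2≤[k+2]² = subst (suc (suc a) ≤_) (sym (expand k)) (ℕ.m≤m+n _ _)
      where
      expand : ∀ k → suc (suc k) ℕ.* suc (suc k) ≡ suc (suc (suc k ℕ.* suc k)) ℕ.+ (k ℕ.+ k ℕ.+ 1)
      expand = ℕ-Solver.solve-∀

  5fib[n²]-superincreasing : Superincreasing (λ n → 5 ℕ.* fib (n ℕ.* n))
  5fib[n²]-superincreasing k = subst (ℕ._≤ 5 ℕ.* fib (suc k ℕ.* suc k))
    (sym (∑<-distribˡ-* k 5 (λ j → fib (suc j ℕ.* suc j)))) (ℕ.*-monoʳ-≤ 5 (fib[n²]-superincreasing k))

  +5*-difference : ∀ x y → + (5 ℕ.* x) - + (5 ℕ.* y) ≡ + 5 * (+ x - + y)
  +5*-difference x y = trans (cong₂ _-_ (ℤ.pos-* 5 x) (ℤ.pos-* 5 y)) (factor (+ x) (+ y))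
    where
    factor : ∀ a b → + 5 * a - + 5 * b ≡ + 5 * (a - b)
    factor = solve-∀

  fib[n²]-dold-≠5 : ∀ {p} e {m} → Prime p → ¬ + p ∣ + 5 → p ℕ.^ e ℕ.∣ m →
                    + (p ℕ.^ suc e) ∣ + fib ((p ℕ.* m) ℕ.* (p ℕ.* m)) - + fib (m ℕ.* m)
  fib[n²]-dold-≠5 {zero} _ p-prime = contradiction (prime>1 p-prime) λ ()
  fib[n²]-dold-≠5 {p@(suc n)} e {m} p-prime p∤5 (ℕ.divides t refl) =
    subst (λ k → + (p ℕ.^ suc e) ∣ + fib k - + fib (m ℕ.* m)) (sym (square n (p ℕ.^ e) t))
      (fib-periodic {L = L ℕ.* p ℕ.^ e} (^-lift-power {x = φ} {L} (φ^[p*p∸1]≈𝟙 p-prime p∤5) e)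
                    (m ℕ.* m) (p ℕ.^ e ℕ.* t ℕ.* t))
    where
    L = p ℕ.* p ℕ.∸ 1
    square : ∀ n a t → (suc n ℕ.* (t ℕ.* a)) ℕ.* (suc n ℕ.* (t ℕ.* a))
                     ≡ t ℕ.* a ℕ.* (t ℕ.* a) ℕ.+ (n ℕ.+ n ℕ.* suc n) ℕ.* a ℕ.* (a ℕ.* t ℕ.* t)
    square = ℕ-Solver.solve-∀

  -- Stated with suc 19 rather than 20: comparing φ ^ 20 with φ ^ suc 19 makes Agda unfold the power, exponentially.
  φ^20≈𝟙 : φ ^ suc 19 ≈ 𝟙 mod + 5
  φ^20≈𝟙 = subst (_≈ 𝟙 mod + 5) (sym (φ^[1+n] 19)) (mk≈ (divides (+ 836) refl , divides (+ 1353) refl))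

  fib[n²]-dold-5 : ∀ e {m} → 5 ℕ.^ e ℕ.∣ m → + (5 ℕ.^ e) ∣ + fib ((5 ℕ.* m) ℕ.* (5 ℕ.* m)) - + fib (m ℕ.* m)
  fib[n²]-dold-5 zero _ = ∣ᵤ⇒∣ (ℕ.1∣ _)
  fib[n²]-dold-5 (suc e) {m} (ℕ.divides t refl) =
    subst (λ k → + (5 ℕ.^ suc e) ∣ + fib k - + fib (m ℕ.* m)) (sym (square (5 ℕ.^ e) t))
      (fib-periodic {L = suc 19 ℕ.* 5 ℕ.^ e} (^-lift-power {x = φ} {suc 19} φ^20≈𝟙 e)
                    (m ℕ.* m) (6 ℕ.* (5 ℕ.* 5 ℕ.^ e) ℕ.* t ℕ.* t))
    where
    square : ∀ a t → 5 ℕ.* (t ℕ.* (5 ℕ.* a)) ℕ.* (5 ℕ.* (t ℕ.* (5 ℕ.* a)))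
                   ≡ t ℕ.* (5 ℕ.* a) ℕ.* (t ℕ.* (5 ℕ.* a)) ℕ.+ 20 ℕ.* a ℕ.* (6 ℕ.* (5 ℕ.* a) ℕ.* t ℕ.* t)
    square = ℕ-Solver.solve-∀

  prime∣5⇒≡5 : ∀ {p} → Prime p → + p ∣ + 5 → p ≡ 5
  prime∣5⇒≡5 p-prime p∣5 with prime⇒irreducible (from-yes (prime? 5)) (∣⇒∣ᵤ p∣5)
  ... | inj₁ refl = contradiction (prime>1 p-prime) (ℕ.<-irrefl refl)
  ... | inj₂ p≡5 = p≡5

  5fib[n²]-dold : DoldCongruences (λ n → 5 ℕ.* fib (n ℕ.* n))
  5fib[n²]-dold {p} e {m} p-prime p^e∣m rewrite +5*-difference (fib ((p ℕ.* m) ℕ.* (p ℕ.* m))) (fib (m ℕ.* m)) with p ℕ.≟ 5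
  ... | yes refl = subst (_∣ _) (sym (ℤ.pos-* 5 (5 ℕ.^ e))) (*-monoʳ-∣ (+ 5) (fib[n²]-dold-5 e p^e∣m))
  ... | no p≢5 = ∣n⇒∣m*n (+ 5) (fib[n²]-dold-≠5 e p-prime (p≢5 ∘ prime∣5⇒≡5 p-prime) p^e∣m)

  fib[25]≢1+5k : ∀ k → fib (5 ℕ.* 5) ≢ 1 ℕ.+ k ℕ.* 5
  fib[25]≢1+5k k eq = contradiction (trans (cong (_% 5) eq) ([m+kn]%n≡m%n 1 k 5)) λ ()

  fib[n²]-not-realizable : ¬ Realizable (λ n → fib (n ℕ.* n))
  fib[n²]-not-realizable realizable =
    uncurry fib[25]≢1+5k (realizable⇒U[p]≡U[1] {U = λ n → fib (n ℕ.* n)} realizable (from-yes (prime? 5)))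

open import Defs
open import Data.Nat using (_*_)
open import Data.Product using (_×_; _,_)
open import Relation.Nullary using (¬_)
open DoldCriterion using (dold⇒realizable)
open FibonacciSquares using (fib[n²]-not-realizable; 5fib[n²]-superincreasing; 5fib[n²]-dold)

theorem1p2 : (¬ Realizable (λ n → fib (n * n))) × Realizable (λ n → 5 * fib (n * n))
theorem1p2 = fib[n²]-not-realizable , dold⇒realizable (λ n → 5 * fib (n * n)) 5fib[n²]-superincreasing 5fib[n²]-dold
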